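{- Let $G$ be a finite unweighted digraph without loops, let $M(t)$ be its directed deformed graph Laplacian, and let $M_1(t),\dots,M_s(t)$ be the directed deformed graph Laplacians of its strongly connected or single node components $G_1,\dots,G_s$. Then for every $\lambda\in\mathbb{C}$, the algebraic multiplicity of $\lambda$ as an eigenvalue of $M(t)$ equals the sum over $i$ of the algebraic multiplicities of $\lambda$ as an eigenvalue of $M_i(t)$ (where the multiplicity is $0$ if $\lambda$ is not an eigenvalue).
   Context: For a digraph with adjacency matrix $A$, $M(t)=I-At+(D-I)t^2+(A-S)t^3$ with $S=A\circ A^T$, $D=\mathrm{diag}(\mathrm{diag}(A^2))$. The algebraic multiplicity of $\lambda$ is its multiplicity as a root of $\det M(t)$. The strongly connected or single node components are the subgraphs induced on the classes of the partition of the vertex set into maximal strongly connected subsets. -}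

module Defs where

open import Level using (Level)
open import Data.Bool using (Bool; true; false)
open import Data.Nat as ℕ using (ℕ; zero; suc)
open import Data.Integer as ℤ using (ℤ; +_)
open import Data.Fin using (Fin; zero; suc; punchIn)
open import Data.Fin.Properties using (_≟_)
open import Data.List using (List; []; _∷_; _++_; [_]; length; lookup; filter; allFin)
open import Data.Product using (Σ; ∃; _×_; _,_)
open import Relation.Nullary using (¬_)
open import Data.Unit using (⊤)
open import Relation.Binary.PropositionalEquality using (_≡_)
open import Relation.Binary.Construct.Closure.ReflexiveTransitive using (Star)
open import Algebra.Bundles using (CommutativeRing)

sumFin : ∀ {a} {R : Set a} → R → (R → R → R) → ∀ n → (Fin n → R) → R
sumFin z _+_ zero    f = z
sumFin z _+_ (suc n) f = f zero + sumFin z _+_ n (λ i → f (suc i))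

record RawOps {a} (R : Set a) : Set a where
  field
    0r 1r : R
    _+r_ _*r_ : R → R → R
    -r_ : R → R

module _ {a} {R : Set a} (ops : RawOps R) where
  open RawOps ops

  sgn : ∀ {n} → Fin n → R → R
  sgn zero    x = x
  sgn (suc j) x = -r (sgn j x)

  det : ∀ n → (Fin n → Fin n → R) → R
  det zero    M = 1r
  det (suc n) M =
    sumFin 0r _+r_ (suc n) (λ j →
      sgn j (M zero j *r det n (λ r c → M (suc r) (punchIn j c))))

-- Integer polynomials, coefficient lists (constant term first)

Polyℤ : Set
Polyℤ = List ℤ

_+ₚ_ : Polyℤ → Polyℤ → Polyℤ
[]       +ₚ q        = q
(a ∷ p)  +ₚ []       = a ∷ p
(a ∷ p)  +ₚ (b ∷ q)  = (a ℤ.+ b) ∷ (p +ₚ q)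

scaleₚ : ℤ → Polyℤ → Polyℤ
scaleₚ c []      = []
scaleₚ c (a ∷ p) = (c ℤ.* a) ∷ scaleₚ c p

_*ₚ_ : Polyℤ → Polyℤ → Polyℤ
[]      *ₚ q = []
(a ∷ p) *ₚ q = scaleₚ a q +ₚ (+ 0 ∷ (p *ₚ q))

-ₚ_ : Polyℤ → Polyℤ
-ₚ p = scaleₚ (ℤ.- (+ 1)) p

polyOps : RawOps Polyℤ
polyOps = record { 0r = [] ; 1r = + 1 ∷ [] ; _+r_ = _+ₚ_ ; _*r_ = _*ₚ_ ; -r_ = -ₚ_ }

Digraph : ℕ → Set
Digraph n = Fin n → Fin n → Bool

Loopless : ∀ {n} → Digraph n → Set
Loopless {n} G = (i : Fin n) → G i i ≡ false

adj : ∀ {n} → Digraph n → Fin n → Fin n → ℤ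
adj G i j with G i j
... | true  = + 1
... | false = + 0

δ : ∀ {n} → Fin n → Fin n → ℤ
δ i j with i ≟ j
... | Relation.Nullary.yes _ = + 1
... | Relation.Nullary.no  _ = + 0

-- M(t) = I - A t + (D - I) t² + (A - S) t³,
-- S = A ∘ Aᵀ (Hadamard), D = diag(diag(A²))
deformedLaplacian : ∀ {n} → Digraph n → Fin n → Fin n → Polyℤ
deformedLaplacian {n} G i j =
  I ∷ (ℤ.- A) ∷ (D ℤ.- I) ∷ (A ℤ.- S) ∷ []
  where
    A = adj G i j
    I = δ i j
    S = adj G i j ℤ.* adj G j i
    D = δ i j ℤ.* sumFin (+ 0) ℤ._+_ n (λ k → adj G i k ℤ.* adj G k i)

charPoly : ∀ {n} → Digraph n → Polyℤ
charPoly {n} G = det polyOps n (deformedLaplacian G)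

Edge : ∀ {n} → Digraph n → Fin n → Fin n → Set
Edge G i j = G i j ≡ true

Reach : ∀ {n} → Digraph n → Fin n → Fin n → Set
Reach G = Star (Edge G)

IsSCCPartition : ∀ {n s} → Digraph n → (Fin n → Fin s) → Set
IsSCCPartition {n} {s} G c =
  ((i j : Fin n) → c i ≡ c j → Reach G i j × Reach G j i) ×
  ((i j : Fin n) → Reach G i j → Reach G j i → c i ≡ c j) ×
  ((k : Fin s) → ∃ λ i → c i ≡ k)

classVertices : ∀ {n s} → (Fin n → Fin s) → Fin s → List (Fin n)
classVertices {n} {s} c k = filter (λ i → c i ≟ k) (allFin n)

induced : ∀ {n} → Digraph n → (vs : List (Fin n)) → Digraph (length vs)
induced G vs a b = G (lookup vs a) (lookup vs b)

component : ∀ {n s} → Digraph n → (c : Fin n → Fin s) → (k : Fin s) →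
            Digraph (length (classVertices c k))
component G c k = induced G (classVertices c k)

module PolyOver {c ℓ} (K : CommutativeRing c ℓ) where
  open CommutativeRing K

  PolyK : Set c
  PolyK = List Carrier

  -- equality of coefficient lists up to trailing zeros
  IsZeroP : PolyK → Set ℓ
  IsZeroP []      = Level.Lift ℓ ⊤
  IsZeroP (a ∷ p) = (a ≈ 0#) × IsZeroP p

  _≈ₚ_ : PolyK → PolyK → Set ℓ
  []      ≈ₚ q       = IsZeroP q
  (a ∷ p) ≈ₚ []      = IsZeroP (a ∷ p)
  (a ∷ p) ≈ₚ (b ∷ q) = (a ≈ b) × (p ≈ₚ q)

  addK : PolyK → PolyK → PolyK
  addK []      q       = q
  addK (a ∷ p) []      = a ∷ p
  addK (a ∷ p) (b ∷ q) = (a + b) ∷ addK p q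

  scaleK : Carrier → PolyK → PolyK
  scaleK x []      = []
  scaleK x (a ∷ p) = (x * a) ∷ scaleK x p

  mulK : PolyK → PolyK → PolyK
  mulK []      q = []
  mulK (a ∷ p) q = addK (scaleK a q) (0# ∷ mulK p q)

  powK : PolyK → ℕ → PolyK
  powK p zero    = 1# ∷ []
  powK p (suc m) = mulK p (powK p m)

  evalK : PolyK → Carrier → Carrier
  evalK []      x = 0#
  evalK (a ∷ p) x = a + x * evalK p x

  fromℕ : ℕ → Carrier
  fromℕ zero    = 0#
  fromℕ (suc m) = 1# + fromℕ m

  fromℤ : ℤ → Carrier
  fromℤ (+ m)        = fromℕ m
  fromℤ ℤ.-[1+ m ]   = - fromℕ (suc m)

  mapℤ : Polyℤ → PolyK
  mapℤ []      = []
  mapℤ (a ∷ p) = fromℤ a ∷ mapℤ p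

  _∣ₚ_ : PolyK → PolyK → Set (c Level.⊔ ℓ)
  d ∣ₚ p = ∃ λ q → p ≈ₚ mulK d q

  linear : Carrier → PolyK
  linear x = (- x) ∷ 1# ∷ []

  RootMultiplicity : PolyK → Carrier → ℕ → Set (c Level.⊔ ℓ)
  RootMultiplicity p x m =
    (powK (linear x) m ∣ₚ p) × ¬ (powK (linear x) (suc m) ∣ₚ p)

  IsField : Set (c Level.⊔ ℓ)
  IsField = (¬ (1# ≈ 0#)) × (∀ x → ¬ (x ≈ 0#) → ∃ λ y → x * y ≈ 1#)

  CharZero : Set ℓ
  CharZero = ∀ m → ¬ (fromℕ (suc m) ≈ 0#)

  AlgClosed : Set (c Level.⊔ ℓ)
  AlgClosed = ∀ (a₀ : Carrier) (as : List Carrier) (a : Carrier) → ¬ (a ≈ 0#) →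
              ∃ λ x → evalK (a₀ ∷ as ++ [ a ]) x ≈ 0#

module Submission where

-- The (i, j) entry of M(t) vanishes unless i = j or i → j is an edge. So if no edge leaves a
-- vertex set P, listing P first makes M(t) block triangular, and every principal minor on a
-- union Q of strong components is the product of its minors on Q ∩ P and Q ∖ P. Splitting
-- repeatedly by the set of vertices reachable from a vertex v (or by the complement of the set
-- of vertices reaching v) leaves single components: det M(t) = ∏ᵢ det of the principal
-- submatrix on Gᵢ, and that submatrix is Mᵢ(t) because the diagonal term (A²)ᵢᵢ only counts
-- 2-cycles, which never leave a component. Over a field the multiplicity of a root of a
-- product is the sum of the multiplicities.

open import Defs
open import Algebra.Bundles using (CommutativeRing)
import Algebra.Properties.CommutativeSemigroup as CommutativeSemigroupProperties
import Algebra.Properties.Ring as RingProperties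
import Algebra.Properties.Semiring.Mult as SemiringMult
import Algebra.Solver.Ring as RingSolver
open import Algebra.Solver.Ring.AlmostCommutativeRing using (fromCommutativeRing; _-Raw-AlmostCommutative⟶_)
open import Data.Bool using (Bool; true; false; not; _∧_; _∨_; T)
import Data.Bool.Properties as Bool
open import Data.Empty using (⊥; ⊥-elim)
open import Data.Fin using (Fin; zero; suc; punchIn)
open import Data.Fin.Properties using (_≟_; any?; suc-injective)
open import Data.Fin.Subset using (Subset; ∣_∣; _∈_; _⊆_)
open import Data.Fin.Subset.Properties using (∣p∣≤n; p⊂q⇒∣p∣<∣q∣)
open import Data.Integer as ℤ using (ℤ; +_; -[1+_]; _⊖_)
import Data.Integer.Properties as ℤ
open import Data.List using (List; []; _∷_; length; lookup; tabulate; filter; filterᵇ; allFin; foldr)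
open import Data.List.Membership.Propositional.Properties using (∈-filter⁻; ∈-lookup)
open import Data.List.Properties using (filter-≐; filter-none; filter-all; tabulate-lookup)
import Data.List.Relation.Unary.All as All
open import Data.List.Relation.Unary.AllPairs using ([]; _∷_)
open import Data.List.Relation.Unary.Unique.Propositional using (Unique)
import Data.List.Relation.Unary.Unique.Propositional.Properties as Unique
open import Data.Maybe using (Maybe; just; nothing)
open import Data.Nat as ℕ using (ℕ; zero; suc; _<_; _≤_; z≤n; s≤s)
import Data.Nat.Properties as ℕ
open import Data.Nat.Solver using (module +-*-Solver)
open import Data.Product using (_×_; _,_; proj₁; proj₂; ∃)
open import Data.Sign as Sign using (Sign)
open import Data.Sum using (_⊎_; inj₁; inj₂)
import Data.Vec as Vec
open import Data.Vec.Properties using (lookup∘tabulate; lookup⇒[]=; []=⇒lookup)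
open import Function using (_∘_; flip; id)
open import Function.Bundles using (mk⇔)
open import Level using (Level; 0ℓ)
open import Relation.Binary.Construct.Closure.ReflexiveTransitive using (Star; ε; _◅_; _◅◅_; reverse)
open import Relation.Binary.Definitions using (tri<; tri≈; tri>)
open import Relation.Binary.PropositionalEquality as ≡ using (_≡_; _≢_)
import Relation.Binary.Reasoning.Setoid as SetoidReasoning
open import Relation.Nullary using (¬_; yes; no; does; _×-dec_)
open import Relation.Nullary.Decidable using (dec-true; dec-false)
open import Relation.Unary using (Pred; Decidable)


module IntegerImage {c ℓ} (R : CommutativeRing c ℓ) where
  open CommutativeRing R
  open RingProperties ring using (-‿involutive; -0#≈0#; -‿+-comm; -‿distribˡ-*)
  open SemiringMult semiring using (×-homo-+; ×1-homo-*) renaming (_×_ to _×ᴿ_)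
  open PolyOver R using (fromℕ; fromℤ)
  open SetoidReasoning setoid

  fromℕ≡×1# : ∀ m → fromℕ m ≡ m ×ᴿ 1#
  fromℕ≡×1# zero    = ≡.refl
  fromℕ≡×1# (suc m) = ≡.cong (λ x → 1# + x) (fromℕ≡×1# m)

  fromℕ-homo-+ : ∀ m n → fromℕ (m ℕ.+ n) ≈ fromℕ m + fromℕ n
  fromℕ-homo-+ m n rewrite fromℕ≡×1# (m ℕ.+ n) | fromℕ≡×1# m | fromℕ≡×1# n = ×-homo-+ 1# m n

  fromℕ-homo-* : ∀ m n → fromℕ (m ℕ.* n) ≈ fromℕ m * fromℕ n
  fromℕ-homo-* m n rewrite fromℕ≡×1# (m ℕ.* n) | fromℕ≡×1# m | fromℕ≡×1# n = ×1-homo-* m n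

  fromℤ-homo-⊖ : ∀ m n → fromℤ (m ⊖ n) ≈ fromℕ m - fromℕ n
  fromℤ-homo-⊖ m       zero    = sym (trans (+-congˡ -0#≈0#) (+-identityʳ _))
  fromℤ-homo-⊖ zero    (suc n) = sym (+-identityˡ _)
  fromℤ-homo-⊖ (suc m) (suc n) = begin
    fromℤ (suc m ⊖ suc n)            ≡⟨ ≡.cong fromℤ (ℤ.[1+m]⊖[1+n]≡m⊖n m n) ⟩
    fromℤ (m ⊖ n)                    ≈⟨ fromℤ-homo-⊖ m n ⟩
    fromℕ m - fromℕ n                ≈⟨ cancel ⟩
    (1# + fromℕ m) - (1# + fromℕ n)  ∎
    where
    cancel : fromℕ m - fromℕ n ≈ (1# + fromℕ m) - (1# + fromℕ n)
    cancel = begin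
      fromℕ m - fromℕ n                         ≈⟨ +-identityˡ _ ⟨
      0# + (fromℕ m - fromℕ n)                  ≈⟨ +-congʳ (-‿inverseʳ 1#) ⟨
      (1# - 1#) + (fromℕ m - fromℕ n)           ≈⟨ +-assoc _ _ _ ⟩
      1# + (- 1# + (fromℕ m - fromℕ n))         ≈⟨ +-congˡ (+-assoc _ _ _) ⟨
      1# + ((- 1# + fromℕ m) - fromℕ n)         ≈⟨ +-congˡ (+-congʳ (+-comm _ _)) ⟩
      1# + ((fromℕ m - 1#) - fromℕ n)           ≈⟨ +-congˡ (+-assoc _ _ _) ⟩
      1# + (fromℕ m + (- 1# - fromℕ n))         ≈⟨ +-assoc _ _ _ ⟨
      (1# + fromℕ m) + (- 1# - fromℕ n)         ≈⟨ +-congˡ (-‿+-comm 1# (fromℕ n)) ⟩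
      (1# + fromℕ m) - (1# + fromℕ n)           ∎

  fromℤ-homo-‿ : ∀ i → fromℤ (ℤ.- i) ≈ - fromℤ i
  fromℤ-homo-‿ (+ zero)  = sym -0#≈0#
  fromℤ-homo-‿ (+ suc n) = refl
  fromℤ-homo-‿ -[1+ n ]  = sym (-‿involutive _)

  fromℤ-homo-+ : ∀ i j → fromℤ (i ℤ.+ j) ≈ fromℤ i + fromℤ j
  fromℤ-homo-+ (+ m)    (+ n)    = fromℕ-homo-+ m n
  fromℤ-homo-+ (+ m)    -[1+ n ] = fromℤ-homo-⊖ m (suc n)
  fromℤ-homo-+ -[1+ m ] (+ n)    = trans (fromℤ-homo-⊖ n (suc m)) (+-comm _ _)
  fromℤ-homo-+ -[1+ m ] -[1+ n ] = begin
    - fromℕ (suc (suc (m ℕ.+ n)))      ≡⟨ ≡.cong (λ k → - fromℕ (suc k)) (ℕ.+-suc m n) ⟨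
    - fromℕ (suc m ℕ.+ suc n)          ≈⟨ -‿cong (fromℕ-homo-+ (suc m) (suc n)) ⟩
    - (fromℕ (suc m) + fromℕ (suc n))  ≈⟨ -‿+-comm _ _ ⟨
    - fromℕ (suc m) - fromℕ (suc n)    ∎

  signed : Sign → Carrier → Carrier
  signed Sign.+ x = x
  signed Sign.- x = - x

  signed-cong : ∀ s {x y} → x ≈ y → signed s x ≈ signed s y
  signed-cong Sign.+ x≈y = x≈y
  signed-cong Sign.- x≈y = -‿cong x≈y

  fromℤ-◃ : ∀ s n → fromℤ (s ℤ.◃ n) ≈ signed s (fromℕ n)
  fromℤ-◃ Sign.- zero    = sym -0#≈0#
  fromℤ-◃ Sign.+ zero    = refl
  fromℤ-◃ Sign.- (suc n) = refl
  fromℤ-◃ Sign.+ (suc n) = refl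

  fromℤ≈signed : ∀ i → fromℤ i ≈ signed (ℤ.sign i) (fromℕ ℤ.∣ i ∣)
  fromℤ≈signed (+ n)    = refl
  fromℤ≈signed -[1+ n ] = refl

  signed-homo-* : ∀ s t x y → signed (s Sign.* t) (x * y) ≈ signed s x * signed t y
  signed-homo-* Sign.+ Sign.+ x y = refl
  signed-homo-* Sign.+ Sign.- x y = trans (-‿cong (*-comm x y)) (trans (-‿distribˡ-* y x) (*-comm _ _))
  signed-homo-* Sign.- Sign.+ x y = -‿distribˡ-* x y
  signed-homo-* Sign.- Sign.- x y = begin
    x * y          ≈⟨ -‿involutive _ ⟨
    - (- (x * y))  ≈⟨ -‿cong (-‿distribˡ-* x y) ⟩
    - (- x * y)    ≈⟨ -‿cong (*-comm _ _) ⟩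
    - (y * - x)    ≈⟨ -‿distribˡ-* y (- x) ⟩
    - y * - x      ≈⟨ *-comm _ _ ⟩
    - x * - y      ∎

  fromℤ-homo-* : ∀ i j → fromℤ (i ℤ.* j) ≈ fromℤ i * fromℤ j
  fromℤ-homo-* i j = begin
    fromℤ (i ℤ.* j)                                             ≈⟨ fromℤ-◃ s (ℤ.∣ i ∣ ℕ.* ℤ.∣ j ∣) ⟩
    signed s (fromℕ (ℤ.∣ i ∣ ℕ.* ℤ.∣ j ∣))                      ≈⟨ signed-cong s (fromℕ-homo-* ℤ.∣ i ∣ ℤ.∣ j ∣) ⟩
    signed s (fromℕ ℤ.∣ i ∣ * fromℕ ℤ.∣ j ∣)                    ≈⟨ signed-homo-* (ℤ.sign i) (ℤ.sign j) _ _ ⟩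
    signed (ℤ.sign i) (fromℕ ℤ.∣ i ∣) * signed (ℤ.sign j) (fromℕ ℤ.∣ j ∣)  ≈⟨ *-cong (fromℤ≈signed i) (fromℤ≈signed j) ⟨
    fromℤ i * fromℤ j                                           ∎
    where s = ℤ.sign i Sign.* ℤ.sign j

  fromℤ-homomorphism : ℤ.+-*-rawRing -Raw-AlmostCommutative⟶ fromCommutativeRing R
  fromℤ-homomorphism = record
    { ⟦_⟧ = fromℤ ; +-homo = fromℤ-homo-+ ; *-homo = fromℤ-homo-* ; -‿homo = fromℤ-homo-‿
    ; 0-homo = refl ; 1-homo = +-identityʳ 1# }

  fromℤ-≟ : ∀ i j → Maybe (fromℤ i ≈ fromℤ j)
  fromℤ-≟ i j with i ℤ.≟ j
  ... | yes ≡.refl = just refl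
  ... | no _       = nothing

  module Solver = RingSolver ℤ.+-*-rawRing (fromCommutativeRing R) fromℤ-homomorphism fromℤ-≟

module Polynomials {c ℓ} (R : CommutativeRing c ℓ) where
  open CommutativeRing R hiding (zero)
  open PolyOver R
  open IntegerImage R using (module Solver)
  open RingProperties ring using (-1*x≈-x)
  open Solver using (solve; _:=_; _:+_)
  open SetoidReasoning setoid

  coeff : PolyK → ℕ → Carrier
  coeff []      i       = 0#
  coeff (a ∷ p) zero    = a
  coeff (a ∷ p) (suc i) = coeff p i

  infix 4 _≋_
  record _≋_ (p q : PolyK) : Set ℓ where
    constructor mk≋
    field coeff-≈ : ∀ i → coeff p i ≈ coeff q i
  open _≋_ public

  ≋-refl : ∀ {p} → p ≋ p
  ≋-refl = mk≋ λ _ → refl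

  ≋-sym : ∀ {p q} → p ≋ q → q ≋ p
  ≋-sym p≋q = mk≋ λ i → sym (coeff-≈ p≋q i)

  ≋-trans : ∀ {p q r} → p ≋ q → q ≋ r → p ≋ r
  ≋-trans p≋q q≋r = mk≋ λ i → trans (coeff-≈ p≋q i) (coeff-≈ q≋r i)

  ≋-reflexive : ∀ {p q} → p ≡ q → p ≋ q
  ≋-reflexive ≡.refl = ≋-refl

  ∷-cong : ∀ {a b p q} → a ≈ b → p ≋ q → a ∷ p ≋ b ∷ q
  ∷-cong a≈b p≋q = mk≋ λ { zero → a≈b ; (suc i) → coeff-≈ p≋q i }

  ∷-injective : ∀ {a b p q} → a ∷ p ≋ b ∷ q → (a ≈ b) × p ≋ q
  ∷-injective e = coeff-≈ e zero , mk≋ λ i → coeff-≈ e (suc i)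

  ∷≋[] : ∀ {a p} → a ∷ p ≋ [] → (a ≈ 0#) × p ≋ []
  ∷≋[] e = coeff-≈ e zero , mk≋ λ i → coeff-≈ e (suc i)

  0∷≋[] : ∀ {a p} → a ≈ 0# → p ≋ [] → a ∷ p ≋ []
  0∷≋[] a≈0 p≋[] = mk≋ λ { zero → a≈0 ; (suc i) → coeff-≈ p≋[] i }

  coeff-addK : ∀ p q i → coeff (addK p q) i ≈ coeff p i + coeff q i
  coeff-addK []      q       i       = sym (+-identityˡ _)
  coeff-addK (a ∷ p) []      zero    = sym (+-identityʳ _)
  coeff-addK (a ∷ p) []      (suc i) = sym (+-identityʳ _)
  coeff-addK (a ∷ p) (b ∷ q) zero    = refl
  coeff-addK (a ∷ p) (b ∷ q) (suc i) = coeff-addK p q i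

  coeff-scaleK : ∀ a p i → coeff (scaleK a p) i ≈ a * coeff p i
  coeff-scaleK a []      i       = sym (zeroʳ a)
  coeff-scaleK a (b ∷ p) zero    = refl
  coeff-scaleK a (b ∷ p) (suc i) = coeff-scaleK a p i

  addK-cong : ∀ {p p′ q q′} → p ≋ p′ → q ≋ q′ → addK p q ≋ addK p′ q′
  addK-cong {p} {p′} {q} {q′} p≋p′ q≋q′ = mk≋ λ i → begin
    coeff (addK p q) i      ≈⟨ coeff-addK p q i ⟩
    coeff p i + coeff q i   ≈⟨ +-cong (coeff-≈ p≋p′ i) (coeff-≈ q≋q′ i) ⟩
    coeff p′ i + coeff q′ i ≈⟨ coeff-addK p′ q′ i ⟨
    coeff (addK p′ q′) i    ∎

  addK-comm : ∀ p q → addK p q ≋ addK q p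
  addK-comm p q = mk≋ λ i →
    trans (coeff-addK p q i) (trans (+-comm _ _) (sym (coeff-addK q p i)))

  addK-assoc : ∀ p q r → addK (addK p q) r ≋ addK p (addK q r)
  addK-assoc p q r = mk≋ λ i → begin
    coeff (addK (addK p q) r) i          ≈⟨ coeff-addK (addK p q) r i ⟩
    coeff (addK p q) i + coeff r i       ≈⟨ +-congʳ (coeff-addK p q i) ⟩
    coeff p i + coeff q i + coeff r i    ≈⟨ +-assoc _ _ _ ⟩
    coeff p i + (coeff q i + coeff r i)  ≈⟨ +-congˡ (coeff-addK q r i) ⟨
    coeff p i + coeff (addK q r) i       ≈⟨ coeff-addK p (addK q r) i ⟨
    coeff (addK p (addK q r)) i          ∎

  addK-identityʳ : ∀ p → addK p [] ≋ p
  addK-identityʳ p = mk≋ λ i → trans (coeff-addK p [] i) (+-identityʳ _)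

  addK-interchange : ∀ p q r s → addK (addK p q) (addK r s) ≋ addK (addK p r) (addK q s)
  addK-interchange p q r s = mk≋ λ i → begin
    coeff (addK (addK p q) (addK r s)) i
      ≈⟨ trans (coeff-addK (addK p q) (addK r s) i) (+-cong (coeff-addK p q i) (coeff-addK r s i)) ⟩
    (coeff p i + coeff q i) + (coeff r i + coeff s i)
      ≈⟨ solve 4 (λ a b c d → (a :+ b) :+ (c :+ d) := (a :+ c) :+ (b :+ d)) refl _ _ _ _ ⟩
    (coeff p i + coeff r i) + (coeff q i + coeff s i)
      ≈⟨ trans (coeff-addK (addK p r) (addK q s) i) (+-cong (coeff-addK p r i) (coeff-addK q s i)) ⟨
    coeff (addK (addK p r) (addK q s)) i
      ∎

  scaleK-cong : ∀ {a b p q} → a ≈ b → p ≋ q → scaleK a p ≋ scaleK b q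
  scaleK-cong {a} {b} {p} {q} a≈b p≋q = mk≋ λ i →
    trans (coeff-scaleK a p i) (trans (*-cong a≈b (coeff-≈ p≋q i)) (sym (coeff-scaleK b q i)))

  scaleK-homo-+ : ∀ a p q → scaleK a (addK p q) ≋ addK (scaleK a p) (scaleK a q)
  scaleK-homo-+ a p q = mk≋ λ i → begin
    coeff (scaleK a (addK p q)) i                ≈⟨ trans (coeff-scaleK a (addK p q) i) (*-congˡ (coeff-addK p q i)) ⟩
    a * (coeff p i + coeff q i)                  ≈⟨ distribˡ _ _ _ ⟩
    a * coeff p i + a * coeff q i                ≈⟨ +-cong (coeff-scaleK a p i) (coeff-scaleK a q i) ⟨
    coeff (scaleK a p) i + coeff (scaleK a q) i  ≈⟨ coeff-addK (scaleK a p) (scaleK a q) i ⟨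
    coeff (addK (scaleK a p) (scaleK a q)) i     ∎

  scaleK-distrib-+ : ∀ a b p → scaleK (a + b) p ≋ addK (scaleK a p) (scaleK b p)
  scaleK-distrib-+ a b p = mk≋ λ i → begin
    coeff (scaleK (a + b) p) i                   ≈⟨ coeff-scaleK (a + b) p i ⟩
    (a + b) * coeff p i                          ≈⟨ distribʳ _ _ _ ⟩
    a * coeff p i + b * coeff p i                ≈⟨ +-cong (coeff-scaleK a p i) (coeff-scaleK b p i) ⟨
    coeff (scaleK a p) i + coeff (scaleK b p) i  ≈⟨ coeff-addK (scaleK a p) (scaleK b p) i ⟨
    coeff (addK (scaleK a p) (scaleK b p)) i     ∎

  scaleK-assoc : ∀ a b p → scaleK (a * b) p ≋ scaleK a (scaleK b p)
  scaleK-assoc a b p = mk≋ λ i → begin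
    coeff (scaleK (a * b) p) i        ≈⟨ coeff-scaleK (a * b) p i ⟩
    a * b * coeff p i                 ≈⟨ *-assoc _ _ _ ⟩
    a * (b * coeff p i)               ≈⟨ *-congˡ (coeff-scaleK b p i) ⟨
    a * coeff (scaleK b p) i          ≈⟨ coeff-scaleK a (scaleK b p) i ⟨
    coeff (scaleK a (scaleK b p)) i   ∎

  scaleK-zero : ∀ p → scaleK 0# p ≋ []
  scaleK-zero p = mk≋ λ i → trans (coeff-scaleK 0# p i) (zeroˡ _)

  scaleK-identity : ∀ p → scaleK 1# p ≋ p
  scaleK-identity p = mk≋ λ i → trans (coeff-scaleK 1# p i) (*-identityˡ _)

  negK : PolyK → PolyK
  negK = scaleK (- 1#)

  addK-inverseʳ : ∀ p → addK p (negK p) ≋ []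
  addK-inverseʳ p = mk≋ λ i → begin
    coeff (addK p (negK p)) i       ≈⟨ trans (coeff-addK p _ i) (+-congˡ (coeff-scaleK (- 1#) p i)) ⟩
    coeff p i + - 1# * coeff p i    ≈⟨ +-congˡ (-1*x≈-x _) ⟩
    coeff p i - coeff p i           ≈⟨ -‿inverseʳ _ ⟩
    0#                              ∎

  shift-addK : ∀ p q → 0# ∷ addK p q ≋ addK (0# ∷ p) (0# ∷ q)
  shift-addK p q = ∷-cong (sym (+-identityˡ 0#)) ≋-refl

  mulK-zeroʳ : ∀ p → mulK p [] ≋ []
  mulK-zeroʳ []      = ≋-refl
  mulK-zeroʳ (a ∷ p) = 0∷≋[] refl (mulK-zeroʳ p)

  mulK-congʳ : ∀ p {q q′} → q ≋ q′ → mulK p q ≋ mulK p q′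
  mulK-congʳ []      q≋q′ = ≋-refl
  mulK-congʳ (a ∷ p) q≋q′ = addK-cong (scaleK-cong refl q≋q′) (∷-cong refl (mulK-congʳ p q≋q′))

  mulK-∷ʳ : ∀ p b q → mulK p (b ∷ q) ≋ addK (scaleK b p) (0# ∷ mulK p q)
  mulK-∷ʳ []      b q = ≋-sym (0∷≋[] refl ≋-refl)
  mulK-∷ʳ (a ∷ p) b q = ∷-cong (+-congʳ (*-comm a b)) (mk≋ λ i → begin
    coeff (addK (scaleK a q) (mulK p (b ∷ q))) i
      ≈⟨ trans (coeff-addK (scaleK a q) (mulK p (b ∷ q)) i) (+-congˡ (coeff-≈ (mulK-∷ʳ p b q) i)) ⟩
    coeff (scaleK a q) i + coeff (addK (scaleK b p) (0# ∷ mulK p q)) i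
      ≈⟨ +-congˡ (coeff-addK (scaleK b p) _ i) ⟩
    coeff (scaleK a q) i + (coeff (scaleK b p) i + coeff (0# ∷ mulK p q) i)
      ≈⟨ solve 3 (λ x y z → x :+ (y :+ z) := y :+ (x :+ z)) refl _ _ _ ⟩
    coeff (scaleK b p) i + (coeff (scaleK a q) i + coeff (0# ∷ mulK p q) i)
      ≈⟨ trans (coeff-addK (scaleK b p) _ i) (+-congˡ (coeff-addK (scaleK a q) _ i)) ⟨
    coeff (addK (scaleK b p) (mulK (a ∷ p) q)) i
      ∎)

  mulK-comm : ∀ p q → mulK p q ≋ mulK q p
  mulK-comm []      q = ≋-sym (mulK-zeroʳ q)
  mulK-comm (a ∷ p) q = ≋-trans (addK-cong ≋-refl (∷-cong refl (mulK-comm p q))) (≋-sym (mulK-∷ʳ q a p))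

  mulK-cong : ∀ {p p′ q q′} → p ≋ p′ → q ≋ q′ → mulK p q ≋ mulK p′ q′
  mulK-cong {p} {p′} {q} {q′} p≋p′ q≋q′ =
    ≋-trans (mulK-comm p q) (≋-trans (mulK-congʳ q p≋p′) (≋-trans (mulK-comm q p′) (mulK-congʳ p′ q≋q′)))

  mulK-distribʳ : ∀ q p p′ → mulK (addK p p′) q ≋ addK (mulK p q) (mulK p′ q)
  mulK-distribʳ q []      p′       = ≋-refl
  mulK-distribʳ q (a ∷ p) []       = ≋-sym (addK-identityʳ _)
  mulK-distribʳ q (a ∷ p) (b ∷ p′) = ≋-trans
    (addK-cong (scaleK-distrib-+ a b q) (≋-trans (∷-cong refl (mulK-distribʳ q p p′)) (shift-addK (mulK p q) (mulK p′ q))))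
    (addK-interchange (scaleK a q) (scaleK b q) (0# ∷ mulK p q) (0# ∷ mulK p′ q))

  mulK-distribˡ : ∀ p q q′ → mulK p (addK q q′) ≋ addK (mulK p q) (mulK p q′)
  mulK-distribˡ p q q′ = ≋-trans (mulK-comm p _)
    (≋-trans (mulK-distribʳ p q q′) (addK-cong (mulK-comm q p) (mulK-comm q′ p)))

  mulK-scaleKˡ : ∀ a p q → mulK (scaleK a p) q ≋ scaleK a (mulK p q)
  mulK-scaleKˡ a []      q = ≋-refl
  mulK-scaleKˡ a (b ∷ p) q = ≋-trans
    (addK-cong (scaleK-assoc a b q) (∷-cong (sym (zeroʳ a)) (mulK-scaleKˡ a p q)))
    (≋-sym (scaleK-homo-+ a (scaleK b q) _))

  mulK-assoc : ∀ p q r → mulK (mulK p q) r ≋ mulK p (mulK q r)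
  mulK-assoc []      q r = ≋-refl
  mulK-assoc (a ∷ p) q r = ≋-trans (mulK-distribʳ r (scaleK a q) _)
    (addK-cong (mulK-scaleKˡ a q r)
               (addK-cong (scaleK-zero r) (∷-cong refl (mulK-assoc p q r))))

  mulK-identityˡ : ∀ p → mulK (1# ∷ []) p ≋ p
  mulK-identityˡ p = ≋-trans (addK-cong (scaleK-identity p) (0∷≋[] refl ≋-refl)) (addK-identityʳ p)

  polyRing : CommutativeRing c ℓ
  polyRing = record
    { Carrier = PolyK ; _≈_ = _≋_ ; _+_ = addK ; _*_ = mulK ; -_ = negK ; 0# = [] ; 1# = 1# ∷ []
    ; isCommutativeRing = record
      { isRing = record
        { +-isAbelianGroup = record
          { isGroup = record
            { isMonoid = record
              { isSemigroup = record
                { isMagma = record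
                  { isEquivalence = record { refl = ≋-refl ; sym = ≋-sym ; trans = ≋-trans }
                  ; ∙-cong = addK-cong }
                ; assoc = addK-assoc }
              ; identity = (λ _ → ≋-refl) , addK-identityʳ }
            ; inverse = (λ p → ≋-trans (addK-comm (negK p) p) (addK-inverseʳ p)) , addK-inverseʳ
            ; ⁻¹-cong = scaleK-cong refl }
          ; comm = addK-comm }
        ; *-cong = mulK-cong
        ; *-assoc = mulK-assoc
        ; *-identity = mulK-identityˡ , (λ p → ≋-trans (mulK-comm p _) (mulK-identityˡ p))
        ; distrib = mulK-distribˡ , mulK-distribʳ }
      ; *-comm = mulK-comm } }

  ≋-[]⇒IsZeroP : ∀ {p} → p ≋ [] → IsZeroP p
  ≋-[]⇒IsZeroP {[]}    _ = _
  ≋-[]⇒IsZeroP {a ∷ p} e = proj₁ (∷≋[] e) , ≋-[]⇒IsZeroP (proj₂ (∷≋[] e))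

  IsZeroP⇒≋-[] : ∀ {p} → IsZeroP p → p ≋ []
  IsZeroP⇒≋-[] {[]}    _          = ≋-refl
  IsZeroP⇒≋-[] {a ∷ p} (a≈0 , z) = 0∷≋[] a≈0 (IsZeroP⇒≋-[] z)

  ≈ₚ⇒≋ : ∀ p q → p ≈ₚ q → p ≋ q
  ≈ₚ⇒≋ []      q       e         = ≋-sym (IsZeroP⇒≋-[] e)
  ≈ₚ⇒≋ (a ∷ p) []      e         = IsZeroP⇒≋-[] e
  ≈ₚ⇒≋ (a ∷ p) (b ∷ q) (a≈b , e) = ∷-cong a≈b (≈ₚ⇒≋ p q e)

  ≋⇒≈ₚ : ∀ p q → p ≋ q → p ≈ₚ q
  ≋⇒≈ₚ []      q       e = ≋-[]⇒IsZeroP (≋-sym e)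
  ≋⇒≈ₚ (a ∷ p) []      e = ≋-[]⇒IsZeroP e
  ≋⇒≈ₚ (a ∷ p) (b ∷ q) e = proj₁ (∷-injective e) , ≋⇒≈ₚ p q (proj₂ (∷-injective e))

module Evaluation {c ℓ} (K : CommutativeRing c ℓ) (x : CommutativeRing.Carrier K) where
  open CommutativeRing K hiding (zero)
  open PolyOver K
  open Polynomials K
  module Solver = IntegerImage.Solver K
  open SetoidReasoning setoid

  ev : PolyK → Carrier
  ev p = evalK p x

  ev-[] : ∀ {p} → p ≋ [] → ev p ≈ 0#
  ev-[] {[]}    _ = refl
  ev-[] {a ∷ p} e = begin
    a + x * ev p  ≈⟨ +-cong (proj₁ (∷≋[] e)) (*-congˡ (ev-[] (proj₂ (∷≋[] e)))) ⟩
    0# + x * 0#   ≈⟨ trans (+-identityˡ _) (zeroʳ x) ⟩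
    0#            ∎

  ev-cong : ∀ {p q} → p ≋ q → ev p ≈ ev q
  ev-cong {[]}    {q}     e = sym (ev-[] (≋-sym e))
  ev-cong {a ∷ p} {[]}    e = ev-[] e
  ev-cong {a ∷ p} {b ∷ q} e = +-cong (proj₁ (∷-injective e)) (*-congˡ (ev-cong (proj₂ (∷-injective e))))

  ev-homo-+ : ∀ p q → ev (addK p q) ≈ ev p + ev q
  ev-homo-+ []      q       = sym (+-identityˡ _)
  ev-homo-+ (a ∷ p) []      = sym (+-identityʳ _)
  ev-homo-+ (a ∷ p) (b ∷ q) = begin
    (a + b) + x * ev (addK p q)        ≈⟨ +-congˡ (*-congˡ (ev-homo-+ p q)) ⟩
    (a + b) + x * (ev p + ev q)        ≈⟨ solve 5 (λ a b x u v → (a :+ b) :+ x :* (u :+ v) := (a :+ x :* u) :+ (b :+ x :* v)) refl a b x (ev p) (ev q) ⟩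
    (a + x * ev p) + (b + x * ev q)    ∎
    where open Solver using (solve; _:=_; _:+_; _:*_)

  ev-homo-scale : ∀ a p → ev (scaleK a p) ≈ a * ev p
  ev-homo-scale a []      = sym (zeroʳ a)
  ev-homo-scale a (b ∷ p) = begin
    a * b + x * ev (scaleK a p)  ≈⟨ +-congˡ (*-congˡ (ev-homo-scale a p)) ⟩
    a * b + x * (a * ev p)       ≈⟨ solve 4 (λ a b x u → a :* b :+ x :* (a :* u) := a :* (b :+ x :* u)) refl a b x (ev p) ⟩
    a * (b + x * ev p)           ∎
    where open Solver using (solve; _:=_; _:+_; _:*_)

  ev-homo-* : ∀ p q → ev (mulK p q) ≈ ev p * ev q
  ev-homo-* []      q = sym (zeroˡ _)
  ev-homo-* (a ∷ p) q = begin
    ev (addK (scaleK a q) (0# ∷ mulK p q))   ≈⟨ ev-homo-+ (scaleK a q) _ ⟩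
    ev (scaleK a q) + (0# + x * ev (mulK p q)) ≈⟨ +-cong (ev-homo-scale a q) (trans (+-identityˡ _) (*-congˡ (ev-homo-* p q))) ⟩
    a * ev q + x * (ev p * ev q)             ≈⟨ solve 4 (λ a x u v → a :* v :+ x :* (u :* v) := (a :+ x :* u) :* v) refl a x (ev p) (ev q) ⟩
    (a + x * ev p) * ev q                    ∎
    where open Solver using (solve; _:=_; _:+_; _:*_)

  ev-linear : ev (linear x) ≈ 0#
  ev-linear = begin
    - x + x * (1# + x * 0#)  ≈⟨ +-congˡ (*-congˡ (trans (+-congˡ (zeroʳ x)) (+-identityʳ 1#))) ⟩
    - x + x * 1#             ≈⟨ +-congˡ (*-identityʳ x) ⟩
    - x + x                  ≈⟨ -‿inverseˡ x ⟩
    0#                       ∎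

  -- Synthetic division by t - x: the quotient's coefficients are Horner evaluations of the tails.
  quotient : PolyK → PolyK
  quotient []      = []
  quotient (a ∷ p) = ev p ∷ quotient p

  quotient-[] : ∀ {p} → p ≋ [] → quotient p ≋ []
  quotient-[] {[]}    _ = ≋-refl
  quotient-[] {a ∷ p} e = 0∷≋[] (ev-[] (proj₂ (∷≋[] e))) (quotient-[] (proj₂ (∷≋[] e)))

  quotient-cong : ∀ {p q} → p ≋ q → quotient p ≋ quotient q
  quotient-cong {[]}    {q}     e = ≋-sym (quotient-[] (≋-sym e))
  quotient-cong {a ∷ p} {[]}    e = quotient-[] e
  quotient-cong {a ∷ p} {b ∷ q} e = ∷-cong (ev-cong (proj₂ (∷-injective e))) (quotient-cong (proj₂ (∷-injective e)))

  quotient-homo-+ : ∀ p q → quotient (addK p q) ≋ addK (quotient p) (quotient q)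
  quotient-homo-+ []      q       = ≋-refl
  quotient-homo-+ (a ∷ p) []      = ≋-sym (addK-identityʳ _)
  quotient-homo-+ (a ∷ p) (b ∷ q) = ∷-cong (ev-homo-+ p q) (quotient-homo-+ p q)

  quotient-*-linear : ∀ f → quotient (mulK f (linear x)) ≋ f
  quotient-*-linear []      = ≋-refl
  quotient-*-linear (a ∷ f) = ∷-cong head tail
    where
    head : ev (addK ((a * 1#) ∷ []) (mulK f (linear x))) ≈ a
    head = begin
      ev (addK ((a * 1#) ∷ []) (mulK f (linear x)))   ≈⟨ ev-homo-+ ((a * 1#) ∷ []) (mulK f (linear x)) ⟩
      (a * 1# + x * 0#) + ev (mulK f (linear x))      ≈⟨ +-cong (trans (+-congˡ (zeroʳ x)) (+-identityʳ _)) (ev-homo-* f (linear x)) ⟩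
      a * 1# + ev f * ev (linear x)                   ≈⟨ +-cong (*-identityʳ a) (trans (*-congˡ ev-linear) (zeroʳ _)) ⟩
      a + 0#                                          ≈⟨ +-identityʳ a ⟩
      a                                               ∎
    tail : quotient (addK ((a * 1#) ∷ []) (mulK f (linear x))) ≋ f
    tail = ≋-trans (quotient-homo-+ ((a * 1#) ∷ []) (mulK f (linear x)))
                   (addK-cong (0∷≋[] refl ≋-refl) (quotient-*-linear f))


module Roots {c ℓ} (K : CommutativeRing c ℓ) (x : CommutativeRing.Carrier K) where
  open CommutativeRing K hiding (zero)
  open RingProperties (CommutativeRing.ring K) using (-1*x≈-x)
  open PolyOver K
  open Polynomials K
  open Evaluation K x public
  module KR = SetoidReasoning setoid
  module ℙ = CommutativeRing polyRing
  module ℙSolver = IntegerImage.Solver polyRing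
  open SetoidReasoning ℙ.setoid

  linear-cancel : ∀ {f g} → mulK (linear x) f ≋ mulK (linear x) g → f ≋ g
  linear-cancel {f} {g} e = begin
    f                                 ≈⟨ quotient-*-linear f ⟨
    quotient (mulK f (linear x))      ≈⟨ quotient-cong (ℙ.trans (mulK-comm f _) (ℙ.trans e (mulK-comm _ g))) ⟩
    quotient (mulK g (linear x))      ≈⟨ quotient-*-linear g ⟩
    g                                 ∎

  const : Carrier → PolyK
  const a = a ∷ []

  t : PolyK
  t = 0# ∷ 1# ∷ []

  ∷≋const+t* : ∀ a p → a ∷ p ≋ addK (const a) (mulK t p)
  ∷≋const+t* a p = ≋-sym (≋-trans
    (addK-cong (≋-refl {const a}) (addK-cong (scaleK-zero p) (∷-cong refl (mulK-identityˡ p))))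
    (∷-cong (+-identityʳ a) ≋-refl))

  linear≋t-const : linear x ≋ addK t (negK (const x))
  linear≋t-const = ∷-cong (trans (sym (-1*x≈-x x)) (sym (+-identityˡ _))) ≋-refl

  division : ∀ p → p ≋ addK (mulK (quotient p) (linear x)) (const (ev p))
  division []      = ≋-sym (0∷≋[] refl ≋-refl)
  division (a ∷ p) = begin
    a ∷ p
      ≈⟨ ∷≋const+t* a p ⟩
    const a ℙ.+ t ℙ.* p
      ≈⟨ addK-cong (≋-refl {const a}) (mulK-congʳ t (division p)) ⟩
    const a ℙ.+ t ℙ.* (Q ℙ.* linear x ℙ.+ const e)
      ≈⟨ addK-cong (≋-refl {const a}) (mulK-congʳ t (addK-cong (mulK-congʳ Q linear≋t-const) (≋-refl {const e}))) ⟩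
    const a ℙ.+ t ℙ.* (Q ℙ.* (t ℙ.- const x) ℙ.+ const e)
      ≈⟨ solve 5 (λ A T Q E X → A :+ T :* (Q :* (T :- X) :+ E) := (E :+ T :* Q) :* (T :- X) :+ (A :+ X :* E)) ℙ.refl (const a) t Q (const e) (const x) ⟩
    (const e ℙ.+ t ℙ.* Q) ℙ.* (t ℙ.- const x) ℙ.+ (const a ℙ.+ const x ℙ.* const e)
      ≈⟨ ℙ.+-cong (ℙ.*-cong (ℙ.sym (∷≋const+t* e Q)) (ℙ.sym linear≋t-const)) (∷-cong (+-congˡ (+-identityʳ _)) ≋-refl) ⟩
    (e ∷ Q) ℙ.* linear x ℙ.+ const (a + x * e)
      ∎
    where
    Q = quotient p
    e = ev p
    open ℙSolver using (solve; _:=_; _:+_; _:*_; _:-_)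

  factor-theorem : ∀ {p} → ev p ≈ 0# → p ≋ mulK (linear x) (quotient p)
  factor-theorem {p} p[x]≈0 = begin
    p                                                    ≈⟨ division p ⟩
    addK (mulK (quotient p) (linear x)) (const (ev p))   ≈⟨ addK-cong (≋-refl {mulK (quotient p) (linear x)}) (0∷≋[] p[x]≈0 ≋-refl) ⟩
    addK (mulK (quotient p) (linear x)) []               ≈⟨ addK-identityʳ _ ⟩
    mulK (quotient p) (linear x)                         ≈⟨ mulK-comm _ _ ⟩
    mulK (linear x) (quotient p)                         ∎

  infix 4 _∣≋_
  _∣≋_ : PolyK → PolyK → Set (c Level.⊔ ℓ)
  d ∣≋ p = ∃ λ q → p ≋ mulK d q

  ∣≋-respʳ : ∀ {d p p′} → p ≋ p′ → d ∣≋ p → d ∣≋ p′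
  ∣≋-respʳ p≋p′ (q , e) = q , ≋-trans (≋-sym p≋p′) e

  L^_ : ℕ → PolyK
  L^ m = powK (linear x) m

  L^-homo-+ : ∀ m n → L^ (m ℕ.+ n) ≋ mulK (L^ m) (L^ n)
  L^-homo-+ zero    n = ≋-sym (mulK-identityˡ (L^ n))
  L^-homo-+ (suc m) n = ≋-trans (mulK-congʳ (linear x) (L^-homo-+ m n)) (≋-sym (mulK-assoc (linear x) (L^ m) (L^ n)))

  L^-∣≋-mono : ∀ {m n p} → m ℕ.≤ n → L^ n ∣≋ p → L^ m ∣≋ p
  L^-∣≋-mono {m} {n} {p} m≤n (q , e) = mulK (L^ (n ℕ.∸ m)) q , (begin
    p                                       ≈⟨ e ⟩
    mulK (L^ n) q                           ≡⟨ ≡.cong (λ k → mulK (L^ k) q) (ℕ.m+[n∸m]≡n m≤n) ⟨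
    mulK (L^ (m ℕ.+ (n ℕ.∸ m))) q           ≈⟨ mulK-cong (L^-homo-+ m (n ℕ.∸ m)) ≋-refl ⟩
    mulK (mulK (L^ m) (L^ (n ℕ.∸ m))) q     ≈⟨ mulK-assoc (L^ m) (L^ (n ℕ.∸ m)) q ⟩
    mulK (L^ m) (mulK (L^ (n ℕ.∸ m)) q)     ∎)

  L^-cancel : ∀ k {f g} → mulK (L^ k) f ≋ mulK (L^ k) g → f ≋ g
  L^-cancel zero    {f} {g} e = ≋-trans (≋-sym (mulK-identityˡ f)) (≋-trans e (mulK-identityˡ g))
  L^-cancel (suc k) {f} {g} e = L^-cancel k (linear-cancel
    (≋-trans (≋-sym (mulK-assoc (linear x) (L^ k) f)) (≋-trans e (mulK-assoc (linear x) (L^ k) g))))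

  record HasMultiplicity (p : PolyK) (m : ℕ) : Set (c Level.⊔ ℓ) where
    constructor multiplicity
    field
      power-divides          : L^ m ∣≋ p
      next-power-not-divides : ¬ (L^ suc m ∣≋ p)

  RootMultiplicity⇒HasMultiplicity : ∀ {p m} → RootMultiplicity p x m → HasMultiplicity p m
  RootMultiplicity⇒HasMultiplicity {p} {m} ((q , e) , L^m+1∤p) =
    multiplicity (q , ≈ₚ⇒≋ p (mulK (L^ m) q) e) λ (q′ , e′) → L^m+1∤p (q′ , ≋⇒≈ₚ p (mulK (L^ suc m) q′) e′)

  HasMultiplicity-resp-≋ : ∀ {p p′ m} → p ≋ p′ → HasMultiplicity p m → HasMultiplicity p′ m
  HasMultiplicity-resp-≋ {m = m} p≋p′ (multiplicity L^m∣p L^m+1∤p) =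
    multiplicity (∣≋-respʳ {L^ m} p≋p′ L^m∣p) λ L^m+1∣p′ → L^m+1∤p (∣≋-respʳ {L^ suc m} (≋-sym p≋p′) L^m+1∣p′)

  HasMultiplicity-unique : ∀ {p m n} → HasMultiplicity p m → HasMultiplicity p n → m ≡ n
  HasMultiplicity-unique {p} {m} {n} (multiplicity L^m∣p L^m+1∤p) (multiplicity L^n∣p L^n+1∤p) with ℕ.<-cmp m n
  ... | tri< m<n _ _ = ⊥-elim (L^m+1∤p (L^-∣≋-mono m<n L^n∣p))
  ... | tri≈ _ m≡n _ = m≡n
  ... | tri> _ _ n<m = ⊥-elim (L^n+1∤p (L^-∣≋-mono n<m L^m∣p))

  cofactor-nonroot : ∀ {p m p₁} → p ≋ mulK (L^ m) p₁ → ¬ (L^ suc m ∣≋ p) → ¬ (ev p₁ ≈ 0#)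
  cofactor-nonroot {p} {m} {p₁} p≋L^mp₁ L^m+1∤p p₁[x]≈0 = L^m+1∤p (quotient p₁ , (begin
    p                                      ≈⟨ p≋L^mp₁ ⟩
    mulK (L^ m) p₁                         ≈⟨ mulK-congʳ (L^ m) (factor-theorem p₁[x]≈0) ⟩
    mulK (L^ m) (mulK (linear x) q₁)       ≈⟨ mulK-assoc (L^ m) (linear x) q₁ ⟨
    mulK (mulK (L^ m) (linear x)) q₁       ≈⟨ mulK-cong (mulK-comm (L^ m) (linear x)) ≋-refl ⟩
    mulK (L^ suc m) q₁                     ∎))
    where q₁ = quotient p₁

  module _ (isField : IsField) where

    *-nonzero : ∀ {a b} → ¬ (a ≈ 0#) → ¬ (b ≈ 0#) → ¬ (a * b ≈ 0#)
    *-nonzero {a} {b} a≉0 b≉0 ab≈0 with proj₂ isField a a≉0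
    ... | a⁻¹ , aa⁻¹≈1 = b≉0 (KR.begin
      b                 KR.≈⟨ *-identityˡ b ⟨
      1# * b            KR.≈⟨ *-congʳ aa⁻¹≈1 ⟨
      (a * a⁻¹) * b     KR.≈⟨ *-congʳ (*-comm a a⁻¹) ⟩
      (a⁻¹ * a) * b     KR.≈⟨ *-assoc a⁻¹ a b ⟩
      a⁻¹ * (a * b)     KR.≈⟨ *-congˡ ab≈0 ⟩
      a⁻¹ * 0#          KR.≈⟨ zeroʳ a⁻¹ ⟩
      0#                KR.∎)

    HasMultiplicity-1 : HasMultiplicity (1# ∷ []) 0
    HasMultiplicity-1 = multiplicity (1# ∷ [] , ≋-sym (mulK-identityˡ _)) λ (q , 1≋Lq) → proj₁ isField (KR.begin
      1#                          KR.≈⟨ trans (+-congˡ (zeroʳ x)) (+-identityʳ 1#) ⟨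
      ev (1# ∷ [])                KR.≈⟨ ev-cong 1≋Lq ⟩
      ev (mulK (L^ 1) q)          KR.≈⟨ ev-homo-* (L^ 1) q ⟩
      ev (L^ 1) * ev q            KR.≈⟨ *-congʳ (ev-cong (mulK-comm (linear x) (1# ∷ []))) ⟩
      ev (mulK (1# ∷ []) (linear x)) * ev q   KR.≈⟨ *-congʳ (ev-cong (mulK-identityˡ (linear x))) ⟩
      ev (linear x) * ev q        KR.≈⟨ *-congʳ ev-linear ⟩
      0# * ev q                   KR.≈⟨ zeroˡ _ ⟩
      0#                          KR.∎)

    HasMultiplicity-* : ∀ {p q m n} → HasMultiplicity p m → HasMultiplicity q n →
                        HasMultiplicity (mulK p q) (m ℕ.+ n)
    HasMultiplicity-* {p} {q} {m} {n} (multiplicity (p₁ , p≋) L^m+1∤p) (multiplicity (q₁ , q≋) L^n+1∤q) =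
      multiplicity (mulK p₁ q₁ , pq≋) L^m+n+1∤pq
      where
      pq≋ : mulK p q ≋ mulK (L^ (m ℕ.+ n)) (mulK p₁ q₁)
      pq≋ = begin
        mulK p q                                   ≈⟨ mulK-cong p≋ q≋ ⟩
        mulK (mulK (L^ m) p₁) (mulK (L^ n) q₁)     ≈⟨ solve 4 (λ A B C D → (A :* B) :* (C :* D) := (A :* C) :* (B :* D)) ℙ.refl (L^ m) p₁ (L^ n) q₁ ⟩
        mulK (mulK (L^ m) (L^ n)) (mulK p₁ q₁)     ≈⟨ mulK-cong (L^-homo-+ m n) ≋-refl ⟨
        mulK (L^ (m ℕ.+ n)) (mulK p₁ q₁)           ∎
        where open ℙSolver using (solve; _:=_; _:*_)
      L^m+n+1∤pq : ¬ (L^ suc (m ℕ.+ n) ∣≋ mulK p q)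
      L^m+n+1∤pq (r , pq≋Lr) = *-nonzero (cofactor-nonroot {p} {m} {p₁} p≋ L^m+1∤p) (cofactor-nonroot {q} {n} {q₁} q≋ L^n+1∤q) (KR.begin
        ev p₁ * ev q₁            KR.≈⟨ ev-homo-* p₁ q₁ ⟨
        ev (mulK p₁ q₁)          KR.≈⟨ ev-cong p₁q₁≋Lr ⟩
        ev (mulK (linear x) r)   KR.≈⟨ ev-homo-* (linear x) r ⟩
        ev (linear x) * ev r     KR.≈⟨ *-congʳ ev-linear ⟩
        0# * ev r                KR.≈⟨ zeroˡ _ ⟩
        0#                       KR.∎)
        where
        p₁q₁≋Lr : mulK p₁ q₁ ≋ mulK (linear x) r
        p₁q₁≋Lr = L^-cancel (m ℕ.+ n) (begin
          mulK (L^ (m ℕ.+ n)) (mulK p₁ q₁)          ≈⟨ pq≋ ⟨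
          mulK p q                                  ≈⟨ pq≋Lr ⟩
          mulK (L^ suc (m ℕ.+ n)) r                 ≈⟨ mulK-cong (mulK-comm (linear x) (L^ (m ℕ.+ n))) ≋-refl ⟩
          mulK (mulK (L^ (m ℕ.+ n)) (linear x)) r   ≈⟨ mulK-assoc (L^ (m ℕ.+ n)) (linear x) r ⟩
          mulK (L^ (m ℕ.+ n)) (mulK (linear x) r)   ∎)

    HasMultiplicity-∏ : ∀ s (f : Fin s → PolyK) (ms : Fin s → ℕ) → (∀ k → HasMultiplicity (f k) (ms k)) →
                        HasMultiplicity (sumFin (1# ∷ []) mulK s f) (sumFin 0 ℕ._+_ s ms)
    HasMultiplicity-∏ zero    f ms _ = HasMultiplicity-1
    HasMultiplicity-∏ (suc s) f ms h =
      HasMultiplicity-* (h zero) (HasMultiplicity-∏ s (λ k → f (suc k)) (λ k → ms (suc k)) (λ k → h (suc k)))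

count : {A : Set} → (A → Bool) → List A → ℕ
count q xs = length (filterᵇ q xs)

-- The number of pairs (a before b) in the list with ¬ q a and q b: the number of adjacent
-- transpositions that move the q-elements to the front.
inversions : {A : Set} → (A → Bool) → List A → ℕ
inversions q []       = 0
inversions q (y ∷ ys) with q y
... | true  = inversions q ys
... | false = count q ys ℕ.+ inversions q ys

count≡0⇒inversions≡0 : {A : Set} (q : A → Bool) (ys : List A) → count q ys ≡ 0 → inversions q ys ≡ 0
count≡0⇒inversions≡0 q []       _ = ≡.refl
count≡0⇒inversions≡0 q (y ∷ ys) e with q y
... | false = ≡.cong₂ ℕ._+_ e (count≡0⇒inversions≡0 q ys e)

count≡0⇒filterᵇ≡[] : {A : Set} (q : A → Bool) (ys : List A) → count q ys ≡ 0 → filterᵇ q ys ≡ []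
count≡0⇒filterᵇ≡[] q ys e with filterᵇ q ys
... | [] = ≡.refl

module Determinants {c ℓ} (R : CommutativeRing c ℓ) where
  open CommutativeRing R hiding (zero)
  open RingProperties ring using (-0#≈0#; -‿involutive; -‿+-comm; -‿distribʳ-*)
  open SetoidReasoning setoid
  module Solver = IntegerImage.Solver R

  ops : RawOps Carrier
  ops = record { 0r = 0# ; 1r = 1# ; _+r_ = _+_ ; _*r_ = _*_ ; -r_ = -_ }

  ∑ : ∀ n → (Fin n → Carrier) → Carrier
  ∑ = sumFin 0# _+_

  ∑-cong : ∀ n {f g : Fin n → Carrier} → (∀ i → f i ≈ g i) → ∑ n f ≈ ∑ n g
  ∑-cong zero    f≈g = refl
  ∑-cong (suc n) f≈g = +-cong (f≈g zero) (∑-cong n (f≈g ∘ suc))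

  ∑-‿ : ∀ n (f : Fin n → Carrier) → ∑ n (λ i → - f i) ≈ - ∑ n f
  ∑-‿ zero    f = sym -0#≈0#
  ∑-‿ (suc n) f = trans (+-congˡ (∑-‿ n (f ∘ suc))) (-‿+-comm _ _)

  sgn-cong : ∀ {n} (j : Fin n) {x y} → x ≈ y → sgn ops j x ≈ sgn ops j y
  sgn-cong zero    x≈y = x≈y
  sgn-cong (suc j) x≈y = -‿cong (sgn-cong j x≈y)

  det-cong : ∀ n {M N : Fin n → Fin n → Carrier} → (∀ i j → M i j ≈ N i j) → det ops n M ≈ det ops n N
  det-cong zero    M≈N = refl
  det-cong (suc n) M≈N = ∑-cong (suc n) λ j →
    sgn-cong j (*-cong (M≈N zero j) (det-cong n λ r c → M≈N (suc r) (punchIn j c)))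

  neg^ : ℕ → Carrier → Carrier
  neg^ zero    x = x
  neg^ (suc n) x = - neg^ n x

  neg^-cong : ∀ n {x y} → x ≈ y → neg^ n x ≈ neg^ n y
  neg^-cong zero    x≈y = x≈y
  neg^-cong (suc n) x≈y = -‿cong (neg^-cong n x≈y)

  neg^-≡ : ∀ {m n} x → m ≡ n → neg^ m x ≈ neg^ n x
  neg^-≡ x ≡.refl = refl

  neg^-+ : ∀ m n x → neg^ (m ℕ.+ n) x ≈ neg^ m (neg^ n x)
  neg^-+ zero    n x = refl
  neg^-+ (suc m) n x = -‿cong (neg^-+ m n x)

  neg^-‿ : ∀ n x → neg^ n (- x) ≈ - neg^ n x
  neg^-‿ zero    x = refl
  neg^-‿ (suc n) x = -‿cong (neg^-‿ n x)

  neg^-even : ∀ n x → neg^ (n ℕ.+ n) x ≈ x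
  neg^-even n x = trans (neg^-+ n n x) (involutive n x)
    where
    involutive : ∀ n x → neg^ n (neg^ n x) ≈ x
    involutive zero    x = refl
    involutive (suc n) x = begin
      - neg^ n (- neg^ n x)   ≈⟨ -‿cong (neg^-‿ n _) ⟩
      - - neg^ n (neg^ n x)   ≈⟨ -‿involutive _ ⟩
      neg^ n (neg^ n x)       ≈⟨ involutive n x ⟩
      x                       ∎

  neg^-0# : ∀ n → neg^ n 0# ≈ 0#
  neg^-0# zero    = refl
  neg^-0# (suc n) = trans (-‿cong (neg^-0# n)) -0#≈0#

  neg^-*ˡ : ∀ n a b → a * neg^ n b ≈ neg^ n (a * b)
  neg^-*ˡ zero    a b = refl
  neg^-*ˡ (suc n) a b = trans (sym (-‿distribʳ-* a _)) (-‿cong (neg^-*ˡ n a b))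

  neg^-linear : ∀ n f a b → f * neg^ n a - neg^ n b ≈ neg^ n (f * a - b)
  neg^-linear n f a b = begin
    f * neg^ n a - neg^ n b         ≈⟨ +-cong (neg^-*ˡ n f a) (sym (neg^-‿ n b)) ⟩
    neg^ n (f * a) + neg^ n (- b)   ≈⟨ homo-+ n (f * a) (- b) ⟨
    neg^ n (f * a - b)              ∎
    where
    homo-+ : ∀ n a b → neg^ n (a + b) ≈ neg^ n a + neg^ n b
    homo-+ zero    a b = refl
    homo-+ (suc n) a b = trans (-‿cong (homo-+ n a b)) (sym (-‿+-comm _ _))

  -- Laplace expansion with rows and columns indexed by lists: `expand x h cs` expands
  -- along row x, with h giving the minor of each remaining list of columns.
  module Expansion {X Y : Set} (f : X → Y → Carrier) where

    expand : X → (List Y → Carrier) → List Y → Carrier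
    expand x h []       = 0#
    expand x h (y ∷ ys) = f x y * h ys - expand x (λ zs → h (y ∷ zs)) ys

    detL : List X → List Y → Carrier
    detL []       cs = 1#
    detL (x ∷ rs) cs = expand x (detL rs) cs

    expand-tabulate : ∀ n x (cf : Fin (suc n) → Y) (h : List Y → Carrier) →
      expand x h (tabulate cf) ≈ ∑ (suc n) (λ j → sgn ops j (f x (cf j) * h (tabulate (cf ∘ punchIn j))))
    expand-tabulate zero    x cf h = +-congˡ -0#≈0#
    expand-tabulate (suc n) x cf h = +-congˡ (begin
      - expand x (λ zs → h (cf zero ∷ zs)) (tabulate (cf ∘ suc))
        ≈⟨ -‿cong (expand-tabulate n x (cf ∘ suc) (λ zs → h (cf zero ∷ zs))) ⟩
      - ∑ (suc n) (λ i → sgn ops i (f x (cf (suc i)) * h (cf zero ∷ tabulate (cf ∘ suc ∘ punchIn i))))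
        ≈⟨ ∑-‿ (suc n) (λ i → sgn ops i (f x (cf (suc i)) * h (cf zero ∷ tabulate (cf ∘ suc ∘ punchIn i)))) ⟨
      ∑ (suc n) (λ i → - sgn ops i (f x (cf (suc i)) * h (cf zero ∷ tabulate (cf ∘ suc ∘ punchIn i))))
        ∎)

    det≈detL : ∀ n (rf : Fin n → X) (cf : Fin n → Y) →
               det ops n (λ a b → f (rf a) (cf b)) ≈ detL (tabulate rf) (tabulate cf)
    det≈detL zero    rf cf = refl
    det≈detL (suc n) rf cf = begin
      det ops (suc n) (λ a b → f (rf a) (cf b))
        ≈⟨ ∑-cong (suc n) (λ j → sgn-cong j (*-congˡ {f (rf zero) (cf j)} (det≈detL n (rf ∘ suc) (cf ∘ punchIn j)))) ⟩
      ∑ (suc n) (λ j → sgn ops j (f (rf zero) (cf j) * detL (tabulate (rf ∘ suc)) (tabulate (cf ∘ punchIn j))))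
        ≈⟨ expand-tabulate n (rf zero) cf (detL (tabulate (rf ∘ suc))) ⟨
      detL (tabulate rf) (tabulate cf)
        ∎

  -- Invariant of the expansion along the rows: the remaining minor h on a column list zs
  -- factors into its q-part g and its (not ∘ q)-part k, up to the sign of the shuffle, when zs
  -- has exactly c q-columns (c = number of p-rows left), and vanishes when it has fewer.
  module BlockTriangular {X Y : Set} (f : X → Y → Carrier) (p : X → Bool) (q : Y → Bool)
         (off-block-zero : ∀ x y → p x ≡ true → q y ≡ false → f x y ≈ 0#) where
    open Expansion f

    Deficient : ℕ → (List Y → Carrier) → Set ℓ
    Deficient c h = ∀ zs → count q zs < c → h zs ≈ 0#

    Balanced : ℕ → ℕ → (List Y → Carrier) → (List Y → Carrier) → (List Y → Carrier) → Set ℓ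
    Balanced c e h g k = ∀ zs → count q zs ≡ c →
      h zs ≈ neg^ (e ℕ.+ inversions q zs) (g (filterᵇ q zs) * k (filterᵇ (not ∘ q) zs))

    Deficient-tail-q : ∀ {y c h} → q y ≡ true → Deficient (suc c) h → Deficient c (h ∘ (y ∷_))
    Deficient-tail-q {y} qy D zs lt with q y | D (y ∷ zs)
    ... | true | D-y∷zs = D-y∷zs (s≤s lt)

    Deficient-tail-q̄ : ∀ {y c h} → q y ≡ false → Deficient c h → Deficient c (h ∘ (y ∷_))
    Deficient-tail-q̄ {y} qy D zs lt with q y | D (y ∷ zs)
    ... | false | D-y∷zs = D-y∷zs lt

    Balanced-tail-q : ∀ {y c e h g k} → q y ≡ true → Balanced (suc c) e h g k →
                      Balanced c e (h ∘ (y ∷_)) (g ∘ (y ∷_)) k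
    Balanced-tail-q {y} qy B zs eq with q y | B (y ∷ zs)
    ... | true | B-y∷zs = B-y∷zs (≡.cong suc eq)

    Balanced-tail-q̄ : ∀ {y c e h g k} → q y ≡ false → Balanced c e h g k →
                      Balanced c (e ℕ.+ c) (h ∘ (y ∷_)) g (k ∘ (y ∷_))
    Balanced-tail-q̄ {y} {c} {e} qy B zs eq with q y | B (y ∷ zs)
    ... | false | B-y∷zs = trans (B-y∷zs eq) (neg^-≡ _
      (≡.trans (≡.cong (λ n → e ℕ.+ (n ℕ.+ inversions q zs)) eq) (≡.sym (ℕ.+-assoc e c _))))

    private
      zero-combination : ∀ {a b c} → b ≈ 0# → c ≈ 0# → a * b - c ≈ 0#
      zero-combination {a} b≈0 c≈0 = trans (+-cong (trans (*-congˡ b≈0) (zeroʳ a)) (trans (-‿cong c≈0) -0#≈0#)) (+-identityʳ 0#)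

      zero-combinationˡ : ∀ {a b c} → a ≈ 0# → c ≈ 0# → a * b - c ≈ 0#
      zero-combinationˡ {a} {b} a≈0 c≈0 = trans (+-cong (trans (*-congʳ a≈0) (zeroˡ b)) (trans (-‿cong c≈0) -0#≈0#)) (+-identityʳ 0#)

    expand-deficient : ∀ x {c h} → Deficient c h → Deficient c (expand x h)
    expand-deficient x     D []       lt = refl
    expand-deficient x {c} D (y ∷ ys) lt with q y in qy
    expand-deficient x {suc c} D (y ∷ ys) (s≤s lt) | true =
      zero-combination (D ys (ℕ.m<n⇒m<1+n lt)) (expand-deficient x (Deficient-tail-q qy D) ys lt)
    ... | false = zero-combination (D ys lt) (expand-deficient x (Deficient-tail-q̄ qy D) ys lt)

    expand-p-vanishes : ∀ {x c h} → p x ≡ true → Deficient c h → ∀ zs → count q zs ≡ c → expand x h zs ≈ 0#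
    expand-p-vanishes px D []       eq = refl
    expand-p-vanishes {x} {c} px D (y ∷ ys) eq with q y in qy
    expand-p-vanishes {x} {suc c} px D (y ∷ ys) eq | true =
      zero-combination (D ys (ℕ.≤-reflexive eq)) (expand-p-vanishes px (Deficient-tail-q qy D) ys (ℕ.suc-injective eq))
    ... | false =
      zero-combinationˡ (off-block-zero x y px qy) (expand-p-vanishes px (Deficient-tail-q̄ qy D) ys eq)

    Deficient-expand-p : ∀ {x c h} → p x ≡ true → Deficient c h → Deficient (suc c) (expand x h)
    Deficient-expand-p {x} px D zs (s≤s le) with ℕ.m≤n⇒m<n∨m≡n le
    ... | inj₁ lt = expand-deficient x D zs lt
    ... | inj₂ eq = expand-p-vanishes px D zs eq

    Balanced-expand-p : ∀ {x c e h g k} → p x ≡ true → Balanced c e h g k → Deficient c h →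
                        Balanced (suc c) e (expand x h) (expand x g) k
    Balanced-expand-p px B D []       ()
    Balanced-expand-p {x} {c} {e} {h} {g} {k} px B D (y ∷ ys) eq with q y in qy
    ... | true = begin
      f x y * h ys - expand x (h ∘ (y ∷_)) ys
        ≈⟨ +-cong (*-congˡ (B ys eq′)) (-‿cong (rest c ≡.refl)) ⟩
      f x y * neg^ E (G₀ * K₀) - neg^ E (X₀ * K₀)
        ≈⟨ neg^-linear E (f x y) (G₀ * K₀) (X₀ * K₀) ⟩
      neg^ E (f x y * (G₀ * K₀) - X₀ * K₀)
        ≈⟨ neg^-cong E (solve 4 (λ F G₀ K₀ X₀ → F :* (G₀ :* K₀) :- X₀ :* K₀ := (F :* G₀ :- X₀) :* K₀) refl (f x y) G₀ K₀ X₀) ⟩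
      neg^ E ((f x y * G₀ - X₀) * K₀)
        ∎
      where
      open Solver using (solve; _:=_; _:-_; _:*_)
      eq′ = ℕ.suc-injective eq
      E = e ℕ.+ inversions q ys
      G₀ = g (filterᵇ q ys)
      K₀ = k (filterᵇ (not ∘ q) ys)
      X₀ = expand x (g ∘ (y ∷_)) (filterᵇ q ys)
      rest : ∀ c′ → c′ ≡ c → expand x (h ∘ (y ∷_)) ys ≈ neg^ E (X₀ * K₀)
      rest zero ≡.refl = begin
        expand x (h ∘ (y ∷_)) ys   ≈⟨ expand-p-vanishes px (λ _ ()) ys eq′ ⟩
        0#                         ≈⟨ trans (neg^-cong E (zeroˡ K₀)) (neg^-0# E) ⟨
        neg^ E (0# * K₀)            ≡⟨ ≡.cong (λ zs → neg^ E (expand x (g ∘ (y ∷_)) zs * K₀)) (count≡0⇒filterᵇ≡[] q ys eq′) ⟨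
        neg^ E (X₀ * K₀)             ∎
      rest (suc c′) ≡.refl = Balanced-expand-p {c = c′} {e} {h ∘ (y ∷_)} {g ∘ (y ∷_)} {k}
                               px (Balanced-tail-q {y} {c′} {e} {h} {g} {k} qy B) (Deficient-tail-q qy D) ys eq′
    ... | false = begin
      f x y * h ys - expand x (h ∘ (y ∷_)) ys
        ≈⟨ +-cong (trans (*-congʳ (off-block-zero x y px qy)) (zeroˡ _)) (-‿cong rest) ⟩
      0# - neg^ (e ℕ.+ c ℕ.+ inversions q ys) Z
        ≈⟨ +-identityˡ _ ⟩
      neg^ (suc (e ℕ.+ c ℕ.+ inversions q ys)) Z
        ≡⟨ ≡.cong (λ n → neg^ n Z) exponent ⟩
      neg^ (e ℕ.+ (count q ys ℕ.+ inversions q ys)) Z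
        ∎
      where
      Z = expand x g (filterᵇ q ys) * k (y ∷ filterᵇ (not ∘ q) ys)
      rest : expand x (h ∘ (y ∷_)) ys ≈ neg^ (e ℕ.+ c ℕ.+ inversions q ys) Z
      rest = Balanced-expand-p {c = c} {e ℕ.+ c} {h ∘ (y ∷_)} {g} {k ∘ (y ∷_)}
               px (Balanced-tail-q̄ {y} {c} {e} {h} {g} {k} qy B) (Deficient-tail-q̄ qy D) ys eq
      exponent : suc (e ℕ.+ c ℕ.+ inversions q ys) ≡ e ℕ.+ (count q ys ℕ.+ inversions q ys)
      exponent rewrite eq = solve 3 (λ e c i → con 1 :+ (e :+ c :+ i) := e :+ ((con 1 :+ c) :+ i)) ≡.refl e c (inversions q ys)
        where open +-*-Solver

    Balanced-expand-p̄ : ∀ {x c e h g k} → p x ≡ false → Balanced c e h g k → Deficient c h →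
                        Balanced c (c ℕ.+ e) (expand x h) g (expand x k)
    Balanced-expand-p̄ {c = c} {e} {g = g} px B D [] _ =
      sym (trans (neg^-cong (c ℕ.+ e ℕ.+ 0) (zeroʳ (g []))) (neg^-0# (c ℕ.+ e ℕ.+ 0)))
    Balanced-expand-p̄ {x} {c} {e} {h} {g} {k} px B D (y ∷ ys) eq with q y in qy
    Balanced-expand-p̄ {x} {suc c} {e} {h} {g} {k} px B D (y ∷ ys) eq | true = begin
      f x y * h ys - expand x (h ∘ (y ∷_)) ys
        ≈⟨ +-cong (trans (*-congˡ (D ys (ℕ.≤-reflexive eq))) (zeroʳ _)) (-‿cong rest) ⟩
      0# - neg^ (c ℕ.+ e ℕ.+ inversions q ys) Z₀
        ≈⟨ +-identityˡ _ ⟩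
      neg^ (suc c ℕ.+ e ℕ.+ inversions q ys) Z₀
        ∎
      where
      Z₀ = g (y ∷ filterᵇ q ys) * expand x k (filterᵇ (not ∘ q) ys)
      rest : expand x (h ∘ (y ∷_)) ys ≈ neg^ (c ℕ.+ e ℕ.+ inversions q ys) Z₀
      rest = Balanced-expand-p̄ {c = c} {e} {h ∘ (y ∷_)} {g ∘ (y ∷_)} {k}
               px (Balanced-tail-q {y} {c} {e} {h} {g} {k} qy B) (Deficient-tail-q qy D) ys (ℕ.suc-injective eq)
    ... | false = begin
      f x y * h ys - expand x (h ∘ (y ∷_)) ys
        ≈⟨ +-cong (*-congˡ (B ys eq)) (-‿cong rest) ⟩
      f x y * neg^ E (G₀ * K₀) - neg^ E (G₀ * X₀)
        ≈⟨ neg^-linear E (f x y) (G₀ * K₀) (G₀ * X₀) ⟩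
      neg^ E (f x y * (G₀ * K₀) - G₀ * X₀)
        ≈⟨ neg^-cong E (factor-G₀ (f x y) G₀ K₀ X₀) ⟩
      neg^ E (G₀ * (f x y * K₀ - X₀))
        ≈⟨ neg^-cancel c E _ ⟨
      neg^ (c ℕ.+ c ℕ.+ E) (G₀ * (f x y * K₀ - X₀))
        ≡⟨ ≡.cong (λ n → neg^ n (G₀ * (f x y * K₀ - X₀))) exponent ⟩
      neg^ (c ℕ.+ e ℕ.+ (count q ys ℕ.+ inversions q ys)) (G₀ * (f x y * K₀ - X₀))
        ∎
      where
      E = e ℕ.+ inversions q ys
      G₀ = g (filterᵇ q ys)
      K₀ = k (filterᵇ (not ∘ q) ys)
      X₀ = expand x (k ∘ (y ∷_)) (filterᵇ (not ∘ q) ys)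
      factor-G₀ : ∀ a b c d → a * (b * c) - b * d ≈ b * (a * c - d)
      factor-G₀ = solve 4 (λ a b c d → a :* (b :* c) :- b :* d := b :* (a :* c :- d)) refl
        where open Solver using (solve; _:=_; _:-_; _:*_)
      neg^-cancel : ∀ c n z → neg^ (c ℕ.+ c ℕ.+ n) z ≈ neg^ n z
      neg^-cancel c n z = trans (neg^-+ (c ℕ.+ c) n z) (neg^-even c _)
      rest : expand x (h ∘ (y ∷_)) ys ≈ neg^ E (G₀ * X₀)
      rest = trans (Balanced-expand-p̄ {c = c} {e ℕ.+ c} {h ∘ (y ∷_)} {g} {k ∘ (y ∷_)}
                      px (Balanced-tail-q̄ {y} {c} {e} {h} {g} {k} qy B) (Deficient-tail-q̄ qy D) ys eq)
                   (trans (neg^-≡ _ shuffle) (neg^-cancel c E _))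
        where
        shuffle : c ℕ.+ (e ℕ.+ c) ℕ.+ inversions q ys ≡ c ℕ.+ c ℕ.+ E
        shuffle = solve 3 (λ c e i → c :+ (e :+ c) :+ i := c :+ c :+ (e :+ i)) ≡.refl c e (inversions q ys)
          where open +-*-Solver
      exponent : c ℕ.+ c ℕ.+ E ≡ c ℕ.+ e ℕ.+ (count q ys ℕ.+ inversions q ys)
      exponent rewrite eq = solve 3 (λ c e i → c :+ c :+ (e :+ i) := c :+ e :+ (c :+ i)) ≡.refl c e (inversions q ys)
        where open +-*-Solver

    detL-splits : ∀ rs → Balanced (count p rs) (inversions p rs) (detL rs) (detL (filterᵇ p rs)) (detL (filterᵇ (not ∘ p) rs))
                      × Deficient (count p rs) (detL rs)
    detL-splits []       = (λ zs eq → sym (trans (neg^-≡ _ (count≡0⇒inversions≡0 q zs eq)) (*-identityˡ 1#))) , λ _ ()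
    detL-splits (x ∷ rs) with p x in px | detL-splits rs
    ... | true  | B , D = Balanced-expand-p {x} {count p rs} {inversions p rs} {detL rs} {detL (filterᵇ p rs)} {detL (filterᵇ (not ∘ p) rs)} px B D
                        , Deficient-expand-p px D
    ... | false | B , D = Balanced-expand-p̄ {x} {count p rs} {inversions p rs} {detL rs} {detL (filterᵇ p rs)} {detL (filterᵇ (not ∘ p) rs)} px B D
                        , expand-deficient x D

  detL-principal-blocks : ∀ {X : Set} (f : X → X → Carrier) (p : X → Bool) →
    (∀ x y → p x ≡ true → p y ≡ false → f x y ≈ 0#) → ∀ vs →
    let open Expansion f in
    detL vs vs ≈ detL (filterᵇ p vs) (filterᵇ p vs) * detL (filterᵇ (not ∘ p) vs) (filterᵇ (not ∘ p) vs)
  detL-principal-blocks f p off-block-zero vs =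
    trans (proj₁ (detL-splits vs) vs ≡.refl) (neg^-even (inversions p vs) _)
    where open BlockTriangular f p p off-block-zero

true≢false : true ≡ false → ⊥
true≢false ()

∧≡true : ∀ {a b} → a ∧ b ≡ true → a ≡ true × b ≡ true
∧≡true {true} {true} _ = ≡.refl , ≡.refl

module BooleanSubsets {n : ℕ} where

  infix 4 _⊆ᵇ_
  _⊆ᵇ_ : (Fin n → Bool) → (Fin n → Bool) → Set
  S ⊆ᵇ T = ∀ x → S x ≡ true → T x ≡ true

  ⊆ᵇ-or-witness : ∀ S T → S ⊆ᵇ T ⊎ ∃ λ z → S z ≡ true × T z ≡ false
  ⊆ᵇ-or-witness S T with any? (λ z → S z Bool.≟ true ×-dec T z Bool.≟ false)
  ... | yes witness = inj₂ witness
  ... | no  ∄       = inj₁ λ x Sx → Bool.¬-not λ Tx≡false → ∄ (x , Sx , Tx≡false)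

  size : (Fin n → Bool) → ℕ
  size S = ∣ Vec.tabulate S ∣

  size≤n : ∀ S → size S ≤ n
  size≤n S = ∣p∣≤n (Vec.tabulate S)

  size-strict : ∀ {S T} z → S ⊆ᵇ T → T z ≡ true → S z ≡ false → size S < size T
  size-strict {S} {T} z S⊆T Tz Sz = p⊂q⇒∣p∣<∣q∣ (⊆ , z , ∈-tabulate T Tz , λ z∈S → true≢false (≡.trans (≡.sym (tabulate-∈ S z∈S)) Sz))
    where
    ∈-tabulate : ∀ U {x} → U x ≡ true → x ∈ Vec.tabulate U
    ∈-tabulate U {x} Ux = lookup⇒[]= x (Vec.tabulate U) (≡.trans (lookup∘tabulate U x) Ux)
    tabulate-∈ : ∀ U {x} → x ∈ Vec.tabulate U → U x ≡ true
    tabulate-∈ U {x} x∈U = ≡.trans (≡.sym (lookup∘tabulate U x)) ([]=⇒lookup x∈U)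
    ⊆ : Vec.tabulate S ⊆ Vec.tabulate T
    ⊆ x∈S = ∈-tabulate T (S⊆T _ (tabulate-∈ S x∈S))

module Closure {n : ℕ} (E : Fin n → Fin n → Bool) (v₀ : Fin n) where
  open BooleanSubsets

  step : (Fin n → Bool) → Fin n → Bool
  step S x = S x ∨ does (any? λ y → S y ∧ E y x Bool.≟ true)

  within : ℕ → Fin n → Bool
  within zero    x = does (v₀ ≟ x)
  within (suc k) x = step (within k) x

  reachable : Fin n → Bool
  reachable = within n

  step-inflationary : ∀ S → S ⊆ᵇ step S
  step-inflationary S x Sx rewrite Sx = ≡.refl

  step-successor : ∀ S {y x} → S y ≡ true → E y x ≡ true → step S x ≡ true
  step-successor S {y} {x} Sy Eyx with any? (λ y → S y ∧ E y x Bool.≟ true)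
  ... | yes _ = Bool.∨-zeroʳ (S x)
  ... | no ∄  = ⊥-elim (∄ (y , ≡.cong₂ _∧_ Sy Eyx))

  step-predecessor : ∀ S {x} → step S x ≡ true → S x ≡ true ⊎ ∃ λ y → S y ≡ true × E y x ≡ true
  step-predecessor S {x} stepSx with S x | any? (λ y → S y ∧ E y x Bool.≟ true)
  ... | true  | _               = inj₁ ≡.refl
  ... | false | yes (y , SyEyx) = inj₂ (y , ∧≡true SyEyx)

  step-monotone : ∀ {S S′} → S ⊆ᵇ S′ → step S ⊆ᵇ step S′
  step-monotone {S} {S′} S⊆S′ x stepSx with step-predecessor S stepSx
  ... | inj₁ Sx             = step-inflationary S′ x (S⊆S′ x Sx)
  ... | inj₂ (y , Sy , Eyx) = step-successor S′ (S⊆S′ y Sy) Eyx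

  within-source : ∀ k → within k v₀ ≡ true
  within-source zero    = dec-true (v₀ ≟ v₀) ≡.refl
  within-source (suc k) = step-inflationary (within k) v₀ (within-source k)

  within⇒Star : ∀ k {x} → within k x ≡ true → Star (λ a b → E a b ≡ true) v₀ x
  within⇒Star zero {x} w with v₀ ≟ x
  ... | yes ≡.refl = ε
  within⇒Star (suc k) w with step-predecessor (within k) w
  ... | inj₁ wx             = within⇒Star k wx
  ... | inj₂ (y , wy , Eyx) = within⇒Star k wy ◅◅ (Eyx ◅ ε)

  -- Each step that is not yet stable adds a vertex, so the iteration is stable by step n.
  stable-or-large : ∀ k → step (within k) ⊆ᵇ within k ⊎ k < size (within k)
  stable-or-large zero = inj₂ (ℕ.≤-<-trans z≤n (size-strict v₀ (λ _ ()) (within-source 0) ≡.refl))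
  stable-or-large (suc k) with ⊆ᵇ-or-witness (within (suc k)) (within k)
  ... | inj₁ shrinks = inj₁ (step-monotone shrinks)
  ... | inj₂ (z , new , old) with stable-or-large k
  ...   | inj₁ stable = ⊥-elim (true≢false (≡.trans (≡.sym (stable z new)) old))
  ...   | inj₂ large  = inj₂ (ℕ.<-≤-trans (s≤s large) (size-strict z (step-inflationary (within k)) new old))

  reachable-source : reachable v₀ ≡ true
  reachable-source = within-source n

  reachable-closed : ∀ {y x} → reachable y ≡ true → E y x ≡ true → reachable x ≡ true
  reachable-closed Ry Eyx with stable-or-large n
  ... | inj₁ stable = stable _ (step-successor reachable Ry Eyx)
  ... | inj₂ large  = ⊥-elim (ℕ.<-irrefl ≡.refl (ℕ.<-≤-trans large (size≤n reachable)))

  reachable⇒Star : ∀ {x} → reachable x ≡ true → Star (λ a b → E a b ≡ true) v₀ x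
  reachable⇒Star = within⇒Star n

  reachable-Star : ∀ {y x} → Star (λ a b → E a b ≡ true) y x → reachable y ≡ true → reachable x ≡ true
  reachable-Star ε         Ry = Ry
  reachable-Star (e ◅ es) Ry = reachable-Star es (reachable-closed Ry e)

filterᵇ-cong : {A : Set} {p q : A → Bool} → (∀ x → p x ≡ q x) → ∀ xs → filterᵇ p xs ≡ filterᵇ q xs
filterᵇ-cong {p = p} {q} p≗q = filter-≐ (Bool.T? ∘ p) (Bool.T? ∘ q)
  ((λ {x} → ≡.subst T (p≗q x)) , (λ {x} → ≡.subst T (≡.sym (p≗q x))))

filterᵇ-filterᵇ : {A : Set} (p q : A → Bool) → ∀ xs → filterᵇ p (filterᵇ q xs) ≡ filterᵇ (λ x → q x ∧ p x) xs
filterᵇ-filterᵇ p q []       = ≡.refl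
filterᵇ-filterᵇ p q (x ∷ xs) with q x
... | false = filterᵇ-filterᵇ p q xs
... | true with p x
...   | true  = ≡.cong (x ∷_) (filterᵇ-filterᵇ p q xs)
...   | false = filterᵇ-filterᵇ p q xs

module ClassFactorisation {c ℓ} (R : CommutativeRing c ℓ) {n s : ℕ} (G : Digraph n)
       (cls : Fin n → Fin s) (isSCC : IsSCCPartition G cls)
       (M : Fin n → Fin n → CommutativeRing.Carrier R)
       (M-non-edge : ∀ x y → x ≢ y → G x y ≡ false → CommutativeRing._≈_ R (M x y) (CommutativeRing.0# R)) where
  open CommutativeRing R hiding (zero)
  open SetoidReasoning setoid
  open Determinants R using (module Expansion; detL-principal-blocks)
  open Expansion M using (detL)
  open BooleanSubsets using (_⊆ᵇ_; size; size≤n; size-strict; ⊆ᵇ-or-witness)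

  minor : (Fin n → Bool) → Carrier
  minor Q = detL (filterᵇ Q (allFin n)) (filterᵇ Q (allFin n))

  inClass : Fin s → Fin n → Bool
  inClass k v = does (cls v ≟ k)

  ∏ : ∀ m → (Fin m → Carrier) → Carrier
  ∏ = sumFin 1# _*_

  ClassUnion : (Fin n → Bool) → Set
  ClassUnion Q = ∀ x y → cls x ≡ cls y → Q x ≡ Q y

  Factorises : (Fin n → Bool) → Set ℓ
  Factorises Q = minor Q ≈ ∏ s (λ k → minor (λ v → Q v ∧ inClass k v))

  ∏-cong : ∀ m {f g : Fin m → Carrier} → (∀ k → f k ≈ g k) → ∏ m f ≈ ∏ m g
  ∏-cong zero    f≈g = refl
  ∏-cong (suc m) f≈g = *-cong (f≈g zero) (∏-cong m (f≈g ∘ suc))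

  ∏-homo-* : ∀ m (f g : Fin m → Carrier) → ∏ m f * ∏ m g ≈ ∏ m (λ k → f k * g k)
  ∏-homo-* zero    f g = *-identityʳ 1#
  ∏-homo-* (suc m) f g = begin
    (f zero * ∏ m (f ∘ suc)) * (g zero * ∏ m (g ∘ suc))   ≈⟨ *-assoc _ _ _ ⟩
    f zero * (∏ m (f ∘ suc) * (g zero * ∏ m (g ∘ suc)))   ≈⟨ *-congˡ (x∙yz≈y∙xz _ _ _) ⟩
    f zero * (g zero * (∏ m (f ∘ suc) * ∏ m (g ∘ suc)))   ≈⟨ *-assoc _ _ _ ⟨
    (f zero * g zero) * (∏ m (f ∘ suc) * ∏ m (g ∘ suc))   ≈⟨ *-congˡ (∏-homo-* m (f ∘ suc) (g ∘ suc)) ⟩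
    (f zero * g zero) * ∏ m (λ k → f (suc k) * g (suc k)) ∎
    where open CommutativeSemigroupProperties *-commutativeSemigroup using (x∙yz≈y∙xz)

  ∏-ones : ∀ m (f : Fin m → Carrier) → (∀ k → f k ≈ 1#) → ∏ m f ≈ 1#
  ∏-ones zero    f f≈1 = refl
  ∏-ones (suc m) f f≈1 = trans (*-cong (f≈1 zero) (∏-ones m (f ∘ suc) (f≈1 ∘ suc))) (*-identityʳ 1#)

  ∏-single : ∀ m (k₀ : Fin m) (f : Fin m → Carrier) → (∀ k → k ≢ k₀ → f k ≈ 1#) → ∏ m f ≈ f k₀
  ∏-single (suc m) zero     f f≈1 =
    trans (*-congˡ (∏-ones m (f ∘ suc) (λ k → f≈1 (suc k) λ ()))) (*-identityʳ _)
  ∏-single (suc m) (suc k₀) f f≈1 =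
    trans (*-congʳ (f≈1 zero λ ())) (trans (*-identityˡ _) (∏-single m k₀ (f ∘ suc) λ k k≢k₀ → f≈1 (suc k) (k≢k₀ ∘ suc-injective)))

  minor-cong : ∀ {Q Q′} → (∀ v → Q v ≡ Q′ v) → minor Q ≈ minor Q′
  minor-cong Q≗Q′ rewrite filterᵇ-cong Q≗Q′ (allFin n) = refl

  minor-empty : ∀ {Q} → (∀ v → Q v ≡ false) → minor Q ≈ 1#
  minor-empty {Q} Q≗false rewrite filter-none (Bool.T? ∘ Q) {allFin n} (All.tabulate λ {v} _ Qv → ≡.subst T (Q≗false v) Qv) = refl

  minor-split : ∀ (P : Fin n → Bool) → (∀ x y → P x ≡ true → P y ≡ false → M x y ≈ 0#) →
                ∀ Q → minor Q ≈ minor (λ v → Q v ∧ P v) * minor (λ v → Q v ∧ not (P v))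
  minor-split P P-closed Q = begin
    minor Q
      ≈⟨ detL-principal-blocks M P P-closed (filterᵇ Q (allFin n)) ⟩
    detL (filterᵇ P Qs) (filterᵇ P Qs) * detL (filterᵇ (not ∘ P) Qs) (filterᵇ (not ∘ P) Qs)
      ≡⟨ ≡.cong₂ (λ as bs → detL as as * detL bs bs) (filterᵇ-filterᵇ P Q (allFin n)) (filterᵇ-filterᵇ (not ∘ P) Q (allFin n)) ⟩
    minor (λ v → Q v ∧ P v) * minor (λ v → Q v ∧ not (P v))
      ∎
    where Qs = filterᵇ Q (allFin n)

  minor-∧-split : ∀ Q b → minor (λ v → Q v ∧ b) * minor (λ v → Q v ∧ not b) ≈ minor Q
  minor-∧-split Q true  = trans (*-cong (minor-cong (Bool.∧-identityʳ ∘ Q)) (minor-empty (Bool.∧-zeroʳ ∘ Q))) (*-identityʳ _)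
  minor-∧-split Q false = trans (*-cong (minor-empty (Bool.∧-zeroʳ ∘ Q)) (minor-cong (Bool.∧-identityʳ ∘ Q))) (*-identityˡ _)

  inClass⇒≡ : ∀ {k v} → inClass k v ≡ true → cls v ≡ k
  inClass⇒≡ {k} {v} _ with cls v ≟ k
  ... | yes eq = eq

  representative : Fin s → Fin n
  representative k = proj₁ (proj₂ (proj₂ isSCC) k)

  ClassUnion-constant : ∀ {P} → ClassUnion P → ∀ k v → inClass k v ≡ true → P v ≡ P (representative k)
  ClassUnion-constant P-union k v v∈k = P-union v (representative k)
    (≡.trans (inClass⇒≡ v∈k) (≡.sym (proj₂ (proj₂ (proj₂ isSCC) k))))

  minor-class-split : ∀ {P} → ClassUnion P → ∀ (Q : Fin n → Bool) k →
    minor (λ v → (Q v ∧ P v) ∧ inClass k v) * minor (λ v → (Q v ∧ not (P v)) ∧ inClass k v)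
      ≈ minor (λ v → Q v ∧ inClass k v)
  minor-class-split {P} P-union Q k = trans
    (*-cong (minor-cong λ v → restrict (Q v) (P v) (inClass k v) b (ClassUnion-constant P-union k v))
            (minor-cong λ v → restrict (Q v) (not (P v)) (inClass k v) (not b) (≡.cong not ∘ ClassUnion-constant P-union k v)))
    (minor-∧-split (λ v → Q v ∧ inClass k v) b)
    where
    b = P (representative k)
    restrict : ∀ a p c b → (c ≡ true → p ≡ b) → (a ∧ p) ∧ c ≡ (a ∧ c) ∧ b
    restrict false p c     b _   = ≡.refl
    restrict true  p false b _   = Bool.∧-zeroʳ p
    restrict true  p true  b p≡b = ≡.trans (Bool.∧-identityʳ p) (p≡b ≡.refl)

  Factorises-split : ∀ {P} → ClassUnion P → (∀ x y → P x ≡ true → P y ≡ false → M x y ≈ 0#) → ∀ (Q : Fin n → Bool) →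
    Factorises (λ v → Q v ∧ P v) → Factorises (λ v → Q v ∧ not (P v)) →
    Factorises Q
  Factorises-split {P} P-union P-closed Q Q∧P Q∧¬P = begin
    minor Q
      ≈⟨ minor-split P P-closed Q ⟩
    minor (λ v → Q v ∧ P v) * minor (λ v → Q v ∧ not (P v))
      ≈⟨ *-cong Q∧P Q∧¬P ⟩
    ∏ s (λ k → minor (λ v → (Q v ∧ P v) ∧ inClass k v)) * ∏ s (λ k → minor (λ v → (Q v ∧ not (P v)) ∧ inClass k v))
      ≈⟨ ∏-homo-* s _ _ ⟩
    ∏ s (λ k → minor (λ v → (Q v ∧ P v) ∧ inClass k v) * minor (λ v → (Q v ∧ not (P v)) ∧ inClass k v))
      ≈⟨ ∏-cong s (minor-class-split P-union Q) ⟩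
    ∏ s (λ k → minor (λ v → Q v ∧ inClass k v))
      ∎

  Factorises-empty : ∀ {Q} → (∀ v → Q v ≡ false) → Factorises Q
  Factorises-empty {Q} Q≗false = trans (minor-empty Q≗false)
    (sym (∏-ones s _ λ k → minor-empty {λ v → Q v ∧ inClass k v} λ v → ≡.cong (_∧ inClass k v) (Q≗false v)))

  Factorises-one-class : ∀ {Q} k₀ → (∀ v → Q v ≡ true → cls v ≡ k₀) → Factorises Q
  Factorises-one-class {Q} k₀ Q⊆k₀ = sym (trans (∏-single s k₀ _ other) (minor-cong same))
    where
    same : ∀ v → Q v ∧ inClass k₀ v ≡ Q v
    same v with Q v in Qv
    ... | true  = dec-true (cls v ≟ k₀) (Q⊆k₀ v Qv)
    ... | false = ≡.refl
    other : ∀ k → k ≢ k₀ → minor (λ v → Q v ∧ inClass k v) ≈ 1#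
    other k k≢k₀ = minor-empty {λ v → Q v ∧ inClass k v} help
      where
      help : ∀ v → Q v ∧ inClass k v ≡ false
      help v with Q v in Qv
      ... | true  = dec-false (cls v ≟ k) λ cls-v≡k → k≢k₀ (≡.trans (≡.sym cls-v≡k) (Q⊆k₀ v Qv))
      ... | false = ≡.refl

  module Around (v₀ : Fin n) where
    module Forward  = Closure G v₀
    module Backward = Closure (flip G) v₀

    forward backward : Fin n → Bool
    forward  = Forward.reachable
    backward = Backward.reachable

    forward-ClassUnion : ClassUnion forward
    forward-ClassUnion x y same = Bool.⇔→≡ {z = true}
      (mk⇔ (Forward.reachable-Star (proj₁ (proj₁ isSCC x y same)))
           (Forward.reachable-Star (proj₂ (proj₁ isSCC x y same))))

    backward-ClassUnion : ClassUnion backward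
    backward-ClassUnion x y same = Bool.⇔→≡ {z = true}
      (mk⇔ (Backward.reachable-Star (reverse id (proj₂ (proj₁ isSCC x y same))))
           (Backward.reachable-Star (reverse id (proj₁ (proj₁ isSCC x y same)))))

    forward-closed : ∀ x y → forward x ≡ true → forward y ≡ false → M x y ≈ 0#
    forward-closed x y Fx Fy = M-non-edge x y
      (λ { ≡.refl → true≢false (≡.trans (≡.sym Fx) Fy) })
      (Bool.¬-not λ Gxy → true≢false (≡.trans (≡.sym (Forward.reachable-closed Fx Gxy)) Fy))

    backward-coclosed : ∀ x y → not (backward x) ≡ true → not (backward y) ≡ false → M x y ≈ 0#
    backward-coclosed x y ¬Bx ¬By = M-non-edge x y
      (λ { ≡.refl → true≢false (≡.trans (≡.sym ¬Bx) ¬By) })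
      (Bool.¬-not λ Gxy → true≢false (≡.trans (≡.sym ¬Bx) (≡.cong not (Backward.reachable-closed (not-false ¬By) Gxy))))
      where
      not-false : ∀ {b} → not b ≡ false → b ≡ true
      not-false {true} _ = ≡.refl

    same-class : ∀ {v} → forward v ≡ true → backward v ≡ true → cls v ≡ cls v₀
    same-class Fv Bv = proj₁ (proj₂ isSCC) _ v₀
      (reverse id (Backward.reachable⇒Star Bv)) (Forward.reachable⇒Star Fv)

  ClassUnion-∧ : ∀ {Q P} → ClassUnion Q → ClassUnion P → ClassUnion (λ v → Q v ∧ P v)
  ClassUnion-∧ Q-union P-union x y same = ≡.cong₂ _∧_ (Q-union x y same) (P-union x y same)

  ClassUnion-not : ∀ {P} → ClassUnion P → ClassUnion (not ∘ P)
  ClassUnion-not P-union x y same = ≡.cong not (P-union x y same)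

  Factorises-shrinking-split : ∀ {b Q P} → (∀ Q′ → size Q′ < b → ClassUnion Q′ → Factorises Q′) →
    size Q ℕ.≤ b → ClassUnion Q → ClassUnion P → (∀ x y → P x ≡ true → P y ≡ false → M x y ≈ 0#) →
    ∀ {y z} → Q y ≡ true → P y ≡ true → Q z ≡ true → P z ≡ false → Factorises Q
  Factorises-shrinking-split {b} {Q} {P} smaller-factorise Q≤b Q-union P-union P-closed {y} {z} Qy Py Qz Pz =
    Factorises-split P-union P-closed Q
      (smaller-factorise _ (shrinks {P} z Qz Pz) (ClassUnion-∧ Q-union P-union))
      (smaller-factorise _ (shrinks {not ∘ P} y Qy (≡.cong not Py)) (ClassUnion-∧ Q-union (ClassUnion-not P-union)))
    where
    shrinks : ∀ {P′} v → Q v ≡ true → P′ v ≡ false → size (λ u → Q u ∧ P′ u) < b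
    shrinks {P′} v Qv P′v = ℕ.<-≤-trans (size-strict v (λ u → proj₁ ∘ ∧≡true) Qv (≡.cong₂ _∧_ Qv P′v)) Q≤b

  -- Peel off the vertices reachable from some v₀ of Q, or those from which v₀ is reachable;
  -- when neither splits Q, all of Q is strongly connected to v₀.
  factorises : ∀ b Q → size Q < b → ClassUnion Q → Factorises Q
  factorises (suc b) Q (s≤s Q≤b) Q-union with any? (λ v → Q v Bool.≟ true)
  ... | no  Q-empty    = Factorises-empty (λ v → Bool.¬-not (Q-empty ∘ (v ,_)))
  ... | yes (v₀ , Qv₀) = peel (⊆ᵇ-or-witness Q forward) (⊆ᵇ-or-witness Q backward)
    where
    open Around v₀
    peel : Q ⊆ᵇ forward ⊎ ∃ (λ z → Q z ≡ true × forward z ≡ false) →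
           Q ⊆ᵇ backward ⊎ ∃ (λ z → Q z ≡ true × backward z ≡ false) → Factorises Q
    peel (inj₂ (z , Qz , Fz)) _                    =
      Factorises-shrinking-split (factorises b) Q≤b Q-union forward-ClassUnion forward-closed Qv₀ Forward.reachable-source Qz Fz
    peel (inj₁ Q⊆F)          (inj₂ (z , Qz , Bz)) =
      Factorises-shrinking-split (factorises b) Q≤b Q-union (ClassUnion-not backward-ClassUnion) backward-coclosed
        Qz (≡.cong not Bz) Qv₀ (≡.cong not Backward.reachable-source)
    peel (inj₁ Q⊆F)          (inj₁ Q⊆B)          =
      Factorises-one-class (cls v₀) λ v Qv → same-class (Q⊆F v Qv) (Q⊆B v Qv)

  det-factorises : det (Determinants.ops R) n M ≈ ∏ s (λ k → minor (inClass k))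
  det-factorises = begin
    det (Determinants.ops R) n M    ≈⟨ Expansion.det≈detL M n id id ⟩
    detL (allFin n) (allFin n)      ≡⟨ ≡.cong (λ vs → detL vs vs) (filter-all (λ _ → Bool.T? true) {allFin n} (All.tabulate λ _ → _)) ⟨
    minor (λ _ → true)              ≈⟨ factorises (suc n) (λ _ → true) (s≤s (size≤n _)) (λ _ _ _ → ≡.refl) ⟩
    ∏ s (λ k → minor (inClass k))   ∎

  filterᵇ-inClass : ∀ k → filterᵇ (inClass k) (allFin n) ≡ classVertices cls k
  filterᵇ-inClass k = filter-≐ (Bool.T? ∘ inClass k) (λ v → cls v ≟ k) (T⇒≡ , ≡⇒T) (allFin n)
    where
    T⇒≡ : ∀ {v} → T (inClass k v) → cls v ≡ k
    T⇒≡ {v} _ with cls v ≟ k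
    ... | yes eq = eq
    ≡⇒T : ∀ {v} → cls v ≡ k → T (inClass k v)
    ≡⇒T {v} eq = ≡.subst T (≡.sym (dec-true (cls v ≟ k) eq)) _

∑ℤ : {A : Set} → (A → ℤ) → List A → ℤ
∑ℤ g = foldr (λ x s → g x ℤ.+ s) (+ 0)

sumFin-tabulate : {A : Set} (g : A → ℤ) → ∀ m (f : Fin m → A) →
                  sumFin (+ 0) ℤ._+_ m (g ∘ f) ≡ ∑ℤ g (tabulate f)
sumFin-tabulate g zero    f = ≡.refl
sumFin-tabulate g (suc m) f = ≡.cong (λ t → g (f zero) ℤ.+ t) (sumFin-tabulate g m (f ∘ suc))

sumFin-lookup : {A : Set} (g : A → ℤ) (xs : List A) →
                sumFin (+ 0) ℤ._+_ (length xs) (g ∘ lookup xs) ≡ ∑ℤ g xs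
sumFin-lookup g []       = ≡.refl
sumFin-lookup g (x ∷ xs) = ≡.cong (λ t → g x ℤ.+ t) (sumFin-lookup g xs)

∑ℤ-filter : {A : Set} {P : Pred A 0ℓ} (P? : Decidable P) (g : A → ℤ) →
            (∀ x → ¬ P x → g x ≡ + 0) → ∀ xs → ∑ℤ g (filter P? xs) ≡ ∑ℤ g xs
∑ℤ-filter P? g g-vanishes []       = ≡.refl
∑ℤ-filter P? g g-vanishes (x ∷ xs) with P? x
... | yes _  = ≡.cong (λ t → g x ℤ.+ t) (∑ℤ-filter P? g g-vanishes xs)
... | no ¬Px = ≡.trans (∑ℤ-filter P? g g-vanishes xs)
                       (≡.sym (≡.trans (≡.cong (ℤ._+ ∑ℤ g xs) (g-vanishes x ¬Px)) (ℤ.+-identityˡ _)))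

lookup-injective : {A : Set} {xs : List A} → Unique xs → ∀ i j → lookup xs i ≡ lookup xs j → i ≡ j
lookup-injective (x∉ ∷ u) zero    zero    _  = ≡.refl
lookup-injective (x∉ ∷ u) zero    (suc j) eq = ⊥-elim (All.lookup x∉ (∈-lookup j) eq)
lookup-injective (x∉ ∷ u) (suc i) zero    eq = ⊥-elim (All.lookup x∉ (∈-lookup i) (≡.sym eq))
lookup-injective (x∉ ∷ u) (suc i) (suc j) eq = ≡.cong suc (lookup-injective u i j eq)

adj-induced : ∀ {n} (G : Digraph n) vs a b → adj (induced G vs) a b ≡ adj G (lookup vs a) (lookup vs b)
adj-induced G vs a b with G (lookup vs a) (lookup vs b)
... | true  = ≡.refl
... | false = ≡.refl

δ-injective : ∀ {m n} (f : Fin m → Fin n) → (∀ i j → f i ≡ f j → i ≡ j) → ∀ i j → δ (f i) (f j) ≡ δ i j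
δ-injective f f-injective i j with i ≟ j | f i ≟ f j
... | yes _   | yes _     = ≡.refl
... | yes i≡j | no fi≢fj  = ⊥-elim (fi≢fj (≡.cong f i≡j))
... | no i≢j  | yes fi≡fj = ⊥-elim (i≢j (f-injective i j fi≡fj))
... | no _    | no _      = ≡.refl

deformedLaplacian-non-edge : ∀ {n} (G : Digraph n) i j → i ≢ j → G i j ≡ false →
                             deformedLaplacian G i j ≡ + 0 ∷ + 0 ∷ + 0 ∷ + 0 ∷ []
deformedLaplacian-non-edge G i j i≢j Gij with i ≟ j | G i j
... | no _    | false = ≡.refl
... | yes i≡j | _     = ⊥-elim (i≢j i≡j)

-- The summand of D = diag(A²); only 2-cycles through u contribute.
mutual-edge-weight : ∀ {n} → Digraph n → Fin n → Fin n → ℤ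
mutual-edge-weight G u w = adj G u w ℤ.* adj G w u

mutual-edge-weight-vanishes : ∀ {n} (G : Digraph n) u w → ¬ (G u w ≡ true × G w u ≡ true) →
                              mutual-edge-weight G u w ≡ + 0
mutual-edge-weight-vanishes G u w ¬mutual with G u w in Guw | G w u in Gwu
... | true  | true  = ⊥-elim (¬mutual (≡.refl , ≡.refl))
... | true  | false = ≡.refl
... | false | _     = ≡.refl

module InducedLaplacian {n} (G : Digraph n) {P : Pred (Fin n) 0ℓ} (P? : Decidable P)
       (mutually-closed : ∀ u w → P u → G u w ≡ true → G w u ≡ true → P w) where

  vs : List (Fin n)
  vs = filter P? (allFin n)

  diagonal-sum : ∀ a → sumFin (+ 0) ℤ._+_ (length vs) (mutual-edge-weight (induced G vs) a)
                      ≡ sumFin (+ 0) ℤ._+_ n (mutual-edge-weight G (lookup vs a))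
  diagonal-sum a = begin
    sumFin (+ 0) ℤ._+_ (length vs) (mutual-edge-weight (induced G vs) a)
      ≡⟨ sumFin-cong (length vs) (λ k → ≡.cong₂ ℤ._*_ (adj-induced G vs a k) (adj-induced G vs k a)) ⟩
    sumFin (+ 0) ℤ._+_ (length vs) (g ∘ lookup vs)
      ≡⟨ sumFin-lookup g vs ⟩
    ∑ℤ g vs
      ≡⟨ ∑ℤ-filter P? g (λ w ¬Pw → mutual-edge-weight-vanishes G u w λ (Guw , Gwu) → ¬Pw (mutually-closed u w Pu Guw Gwu)) (allFin n) ⟩
    ∑ℤ g (allFin n)
      ≡⟨ sumFin-tabulate g n id ⟨
    sumFin (+ 0) ℤ._+_ n g
      ∎
    where
    open ≡.≡-Reasoning
    u = lookup vs a
    g = mutual-edge-weight G u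
    Pu : P u
    Pu = proj₂ (∈-filter⁻ P? {xs = allFin n} (∈-lookup a))
    sumFin-cong : ∀ m {f h : Fin m → ℤ} → (∀ k → f k ≡ h k) → sumFin (+ 0) ℤ._+_ m f ≡ sumFin (+ 0) ℤ._+_ m h
    sumFin-cong zero    f≗h = ≡.refl
    sumFin-cong (suc m) f≗h = ≡.cong₂ ℤ._+_ (f≗h zero) (sumFin-cong m (f≗h ∘ suc))

  deformedLaplacian-induced : ∀ a b → deformedLaplacian (induced G vs) a b ≡ deformedLaplacian G (lookup vs a) (lookup vs b)
  deformedLaplacian-induced a b =
    ≡.cong₂ _∷_ I≡ (≡.cong₂ _∷_ (≡.cong ℤ.-_ A≡)
      (≡.cong₂ _∷_ (≡.cong₂ ℤ._-_ (≡.cong₂ ℤ._*_ I≡ (diagonal-sum a)) I≡)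
        (≡.cong₂ _∷_ (≡.cong₂ ℤ._-_ A≡ (≡.cong₂ ℤ._*_ A≡ (adj-induced G vs b a))) ≡.refl)))
    where
    I≡ : δ a b ≡ δ (lookup vs a) (lookup vs b)
    I≡ = ≡.sym (δ-injective (lookup vs) (lookup-injective (Unique.filter⁺ P? (Unique.allFin⁺ n))) a b)
    A≡ = adj-induced G vs a b

module IntegerPolynomials {c ℓ} (K : CommutativeRing c ℓ) where
  open CommutativeRing K using (refl; +-identityʳ; 1#; -‿cong)
  open PolyOver K
  open Polynomials K
  open IntegerImage K using (fromℤ-homo-+; fromℤ-homo-*)
  module ℙDet = Determinants polyRing

  mapℤ-homo-+ : ∀ p q → mapℤ (p +ₚ q) ≋ addK (mapℤ p) (mapℤ q)
  mapℤ-homo-+ []      q       = ≋-refl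
  mapℤ-homo-+ (a ∷ p) []      = ≋-refl
  mapℤ-homo-+ (a ∷ p) (b ∷ q) = ∷-cong (fromℤ-homo-+ a b) (mapℤ-homo-+ p q)

  mapℤ-homo-scale : ∀ a p → mapℤ (scaleₚ a p) ≋ scaleK (fromℤ a) (mapℤ p)
  mapℤ-homo-scale a []      = ≋-refl
  mapℤ-homo-scale a (b ∷ p) = ∷-cong (fromℤ-homo-* a b) (mapℤ-homo-scale a p)

  mapℤ-homo-* : ∀ p q → mapℤ (p *ₚ q) ≋ mulK (mapℤ p) (mapℤ q)
  mapℤ-homo-* []      q = ≋-refl
  mapℤ-homo-* (a ∷ p) q = ≋-trans (mapℤ-homo-+ (scaleₚ a q) (+ 0 ∷ (p *ₚ q)))
    (addK-cong (mapℤ-homo-scale a q) (∷-cong refl (mapℤ-homo-* p q)))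

  mapℤ-homo-‿ : ∀ p → mapℤ (-ₚ p) ≋ negK (mapℤ p)
  mapℤ-homo-‿ p = ≋-trans (mapℤ-homo-scale (ℤ.- (+ 1)) p) (scaleK-cong (-‿cong (+-identityʳ 1#)) ≋-refl)

  mapℤ-homo-∑ : ∀ m (f : Fin m → Polyℤ) → mapℤ (sumFin [] _+ₚ_ m f) ≋ ℙDet.∑ m (mapℤ ∘ f)
  mapℤ-homo-∑ zero    f = ≋-refl
  mapℤ-homo-∑ (suc m) f = ≋-trans (mapℤ-homo-+ (f zero) _) (addK-cong ≋-refl (mapℤ-homo-∑ m (f ∘ suc)))

  mapℤ-homo-sgn : ∀ {m} (j : Fin m) p → mapℤ (sgn polyOps j p) ≋ sgn ℙDet.ops j (mapℤ p)
  mapℤ-homo-sgn zero    p = ≋-refl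
  mapℤ-homo-sgn (suc j) p = ≋-trans (mapℤ-homo-‿ (sgn polyOps j p)) (scaleK-cong refl (mapℤ-homo-sgn j p))

  mapℤ-homo-det : ∀ m (A : Fin m → Fin m → Polyℤ) → mapℤ (det polyOps m A) ≋ det ℙDet.ops m (λ a b → mapℤ (A a b))
  mapℤ-homo-det zero    A = ∷-cong (+-identityʳ 1#) ≋-refl
  mapℤ-homo-det (suc m) A = ≋-trans (mapℤ-homo-∑ (suc m) term) (ℙDet.∑-cong (suc m) λ j →
    ≋-trans (mapℤ-homo-sgn j _) (ℙDet.sgn-cong j
      (≋-trans (mapℤ-homo-* (A zero j) _) (mulK-congʳ (mapℤ (A zero j)) (mapℤ-homo-det m (submatrix j))))))
    where
    submatrix : Fin (suc m) → Fin m → Fin m → Polyℤ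
    submatrix j r c = A (suc r) (punchIn j c)
    term : Fin (suc m) → Polyℤ
    term j = sgn polyOps j (A zero j *ₚ det polyOps m (submatrix j))

module LaplacianFactorisation {c ℓ} (K : CommutativeRing c ℓ) {n s} (G : Digraph n)
       (cls : Fin n → Fin s) (isSCC : IsSCCPartition G cls) where
  open PolyOver K
  open Polynomials K
  open IntegerPolynomials K
  open SetoidReasoning (CommutativeRing.setoid polyRing)

  L : Fin n → Fin n → PolyK
  L i j = mapℤ (deformedLaplacian G i j)

  L-non-edge : ∀ i j → i ≢ j → G i j ≡ false → L i j ≋ []
  L-non-edge i j i≢j Gij = ≋-trans (≋-reflexive (≡.cong mapℤ (deformedLaplacian-non-edge G i j i≢j Gij)))
    (0∷≋[] refl (0∷≋[] refl (0∷≋[] refl (0∷≋[] refl ≋-refl))))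
    where open CommutativeRing K using (refl)

  open ClassFactorisation polyRing G cls isSCC L L-non-edge using (minor; inClass; filterᵇ-inClass; ∏; ∏-cong; det-factorises)
  open ℙDet.Expansion L using (detL)

  minor≋component : ∀ k → minor (inClass k) ≋ mapℤ (charPoly (component G cls k))
  minor≋component k = begin
    minor (inClass k)
      ≡⟨ ≡.cong (λ us → detL us us) (filterᵇ-inClass k) ⟩
    detL vs vs
      ≡⟨ ≡.cong₂ detL (tabulate-lookup vs) (tabulate-lookup vs) ⟨
    detL (tabulate (lookup vs)) (tabulate (lookup vs))
      ≈⟨ ℙDet.Expansion.det≈detL L (length vs) (lookup vs) (lookup vs) ⟨
    det ℙDet.ops (length vs) (λ a b → L (lookup vs a) (lookup vs b))
      ≈⟨ ℙDet.det-cong (length vs) (λ a b → ≋-reflexive (≡.cong mapℤ (≡.sym (deformedLaplacian-induced a b)))) ⟩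
    det ℙDet.ops (length vs) (λ a b → mapℤ (deformedLaplacian (induced G vs) a b))
      ≈⟨ mapℤ-homo-det (length vs) (deformedLaplacian (induced G vs)) ⟨
    mapℤ (charPoly (component G cls k))
      ∎
    where
    open InducedLaplacian G (λ v → cls v ≟ k)
      (λ u w cls-u≡k Guw Gwu → ≡.trans (≡.sym (proj₁ (proj₂ isSCC) u w (Guw ◅ ε) (Gwu ◅ ε))) cls-u≡k)

  charPoly-factorises : mapℤ (charPoly G) ≋ ∏ s (λ k → mapℤ (charPoly (component G cls k)))
  charPoly-factorises = begin
    mapℤ (charPoly G)                               ≈⟨ mapℤ-homo-det n (deformedLaplacian G) ⟩
    det ℙDet.ops n L                                 ≈⟨ det-factorises ⟩
    ∏ s (λ k → minor (inClass k))                    ≈⟨ ∏-cong s minor≋component ⟩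
    ∏ s (λ k → mapℤ (charPoly (component G cls k)))  ∎

open import Data.Nat using (_+_)

proposition3p3 : ∀ {c ℓ : Level} (K : CommutativeRing c ℓ) →
    PolyOver.IsField K → PolyOver.CharZero K → PolyOver.AlgClosed K →
    ∀ {n s : ℕ} (G : Digraph n) → Loopless G →
    (cls : Fin n → Fin s) → IsSCCPartition G cls →
    ∀ (x : CommutativeRing.Carrier K) (m : ℕ) (ms : Fin s → ℕ) →
    PolyOver.RootMultiplicity K (PolyOver.mapℤ K (charPoly G)) x m →
    ((k : Fin s) → PolyOver.RootMultiplicity K
                     (PolyOver.mapℤ K (charPoly (component G cls k))) x (ms k)) →
    m ≡ sumFin 0 _+_ s ms
proposition3p3 K isField _ _ {s = s} G _ cls isSCC x m ms m-mult ms-mult =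
  HasMultiplicity-unique (RootMultiplicity⇒HasMultiplicity m-mult)
    (HasMultiplicity-resp-≋ (≋-sym charPoly-factorises)
      (HasMultiplicity-∏ isField s _ ms (RootMultiplicity⇒HasMultiplicity ∘ ms-mult)))
  where
  open Polynomials K using (≋-sym)
  open Roots K x
  open LaplacianFactorisation K G cls isSCC using (charPoly-factorises)
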